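{- For each $n,m\ge 0$, \[ \mathfrak{S}\times\mathcal{G}_m=\mathrm{Bal}(m\mathit{L}^c) \quad\text{and}\quad |\mathcal{G}_m[n]|=\frac{1}{n!}\sum_{k=0}^n {n\brack k}\, m^k\, \mathrm{fub}(k). \]
   Context: Equality of $\mathbb{L}$-species (species on finite totally ordered sets) means natural isomorphism, which for $\mathbb{L}$-species is equivalent to equinumerosity of structures on every $n$-element set. For a finite totally ordered set $\ell=\{u_1<\dots<u_n\}$, a $\mathcal{G}_m$-structure on $\ell$ is a matrix with $m$ rows and some number $k\ge0$ of columns whose entries are linear orders (words with distinct letters, possibly empty) of pairwise disjoint sets, such that concatenating the entries column by column (top to bottom within a column, columns left to right) gives $u_1u_2\cdots u_n$, and every column has at least one nonempty entry; $\mathcal{G}_m[n]=\mathcal{G}_m[\{1,\dots,n\}]$. (Equivalently, $|\mathcal{G}_m[n]|$ is the number of $m$-row matrices with nonnegative integer entries summing to $n$ and no zero column.) $(\mathfrak{S}\times\mathcal{G}_m)[\ell]$ consists of pairs $(w,A)$ with $w$ a permutation of $\ell$ and $A\in\mathcal{G}_m[\ell]$. A connected linear order is a linear order of a nonempty set beginning with the minimum of that set. A $\mathrm{Bal}(m\mathit{L}^c)$-structure on $\ell$ consists of a set partition of $\ell$, each block of which carries a connected linear order and a color from $\{1,\dots,m\}$, together with a ballot (ordered set partition, i.e. a sequence of disjoint nonempty sets whose union is the given set) of the set of blocks. ${n\brack k}$ is the unsigned Stirling number of the first kind (permutations of $[n]$ with $k$ cycles) and $\mathrm{fub}(k)$ is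 the $k$th Fubini number, the number of ballots of $\{1,\dots,k\}$ ($\mathrm{fub}(0)=1$). -}

module Defs where

open import Data.Nat using (ℕ; zero; suc; _+_; _*_; _∸_; _^_; _≤_; _!)
open import Data.Fin using (Fin; _<_)
open import Data.Fin.Properties using (_≟_)
open import Data.List using (List; []; _∷_; length; concat; map; upTo; allFin)
open import Data.Nat.ListAction using (sum)
open import Data.List.Relation.Unary.All using (All)
open import Data.List.Relation.Unary.Linked using (Linked)
import Data.List.Relation.Unary.Unique.DecPropositional as UniqueDec
open import Data.Vec using (Vec; toList)
import Data.Vec.Relation.Unary.All as VAll
open import Data.Product using (Σ; _×_; proj₁; proj₂; _,_)
open import Relation.Binary.PropositionalEquality using (_≡_)
open import Relation.Nullary.Decidable using (True)

sumTo : ℕ → (ℕ → ℕ) → ℕ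
sumTo n f = sum (map f (upTo (suc n)))

stirling1 : ℕ → ℕ → ℕ
stirling1 zero    zero    = 1
stirling1 zero    (suc k) = 0
stirling1 (suc n) zero    = 0
stirling1 (suc n) (suc k) = n * stirling1 n (suc k) + stirling1 n k

stirling2 : ℕ → ℕ → ℕ
stirling2 zero    zero    = 1
stirling2 zero    (suc k) = 0
stirling2 (suc n) zero    = 0
stirling2 (suc n) (suc k) = suc k * stirling2 n (suc k) + stirling2 n k

-- Fubini numbers: ballots of [n] = set partitions into k blocks, blocks ordered
fub : ℕ → ℕ
fub n = sumTo n (λ k → (k !) * stirling2 n k)

-- The totally ordered set ℓ = {0 < 1 < ... < n-1} is  Fin n.

-- words with distinct letters (linear orders of subsets of Fin n)
Distinct : ∀ {n} → List (Fin n) → Set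
Distinct {n} w = True (UniqueDec.unique? (_≟_ {n}) w)

Perm : ℕ → Set
Perm n = Σ (List (Fin n)) (λ w → Distinct w × length w ≡ n)

-- G_m-structures on Fin n: a matrix with m rows and k columns, stored as a
-- vector of k columns, each column a vector of its m entries (top to bottom);
-- column-by-column concatenation must be 0 1 ... n-1, and every column has a
-- nonempty entry.
columnWord : ∀ {n m} → Vec (List (Fin n)) m → List (Fin n)
columnWord col = concat (toList col)

matrixWord : ∀ {n m k} → Vec (Vec (List (Fin n)) m) k → List (Fin n)
matrixWord A = concat (map columnWord (toList A))

G : ℕ → ℕ → Set
G m n = Σ ℕ (λ k → Σ (Vec (Vec (List (Fin n)) m) k) (λ A →
          (matrixWord A ≡ allFin n) ×
          VAll.All (λ col → 1 ≤ length (columnWord col)) A))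

SxG : ℕ → ℕ → Set
SxG m n = Perm n × G m n

-- Bal(m L^c)-structures on Fin n.
-- A connected linear order: a nonempty word x xs whose first letter x is its
-- minimum.
ConnWord : ℕ → Set
ConnWord n = Σ (Fin n × List (Fin n)) (λ p → All (proj₁ p <_) (proj₂ p))

firstLetter : ∀ {n} → ConnWord n → Fin n
firstLetter w = proj₁ (proj₁ w)

wordOf : ∀ {n} → ConnWord n → List (Fin n)
wordOf w = proj₁ (proj₁ w) ∷ proj₂ (proj₁ w)

-- a block: connected linear order together with a colour in {1..m} (= Fin m)
CBlock : ℕ → ℕ → Set
CBlock n m = ConnWord n × Fin m

-- a nonempty finite set of blocks, represented canonically as a nonempty list
-- of blocks sorted strictly increasingly by their minima
Level : ℕ → ℕ → Set
Level n m = Σ (CBlock n m × List (CBlock n m)) (λ p →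
              Linked (λ b c → firstLetter (proj₁ b) < firstLetter (proj₁ c))
                     (proj₁ p ∷ proj₂ p))

levelBlocks : ∀ {n m} → Level n m → List (CBlock n m)
levelBlocks l = proj₁ (proj₁ l) ∷ proj₂ (proj₁ l)

ballotWord : ∀ {n m} → List (Level n m) → List (Fin n)
ballotWord ls = concat (map (λ l → concat (map (λ b → wordOf (proj₁ b)) (levelBlocks l))) ls)

-- Bal(m L^c)[n]: a ballot (sequence of nonempty sets) of coloured connected
-- blocks, whose blocks partition Fin n (every letter occurs exactly once).
Bal : ℕ → ℕ → Set
Bal m n = Σ (List (Level n m)) (λ ls →
            Distinct (ballotWord ls) × length (ballotWord ls) ≡ n)

-- Filling the shape of a 𝒢_m-matrix with a permutation w gives a matrix of words with reading
-- word w, and conversely. Cutting each entry of such a matrix at its left-to-right minima gives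
-- connected blocks with decreasing leads, so the entry can be recovered from its set of blocks.
-- Colouring the blocks by their row and gathering those of one column into a set turns the
-- matrix into a ballot of coloured connected blocks.
--
-- The number of m × j matrices of naturals with entry sum n and no zero column is the
-- coefficient of xⁿ in C(x)ʲ, where C = (1 − x)⁻ᵐ − 1 satisfies (1 − x)C′ = m(C + 1). Since
-- (1 − x)d/dx is a derivation, n! times this coefficient satisfies the same recurrence in j and
-- n as j! ∑ₖ [n k] S(k, j) mᵏ, and summing over j turns j! S(k, j) into fub(k).
module Submission where

open import Defs
open import Data.Nat using (ℕ; suc; _*_; _^_; _!)
open import Data.Fin using (Fin)
open import Data.Product using (Σ; _×_; _,_)
open import Function.Bundles using (_↔_)
open import Relation.Binary.PropositionalEquality using (_≡_)

module Counting where

  open import Defs using (sumTo; stirling1; stirling2; fub)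
  open import Data.Nat using (ℕ; zero; suc; pred; _+_; _*_; _∸_; _^_; _≤_; _<_; _!; z≤n; s≤s)
  open import Data.Nat.Properties
  open import Data.List using (map; applyUpTo)
  open import Data.Nat.ListAction using (sum)
  open import Data.Nat.Tactic.RingSolver using (solve-∀)
  open import Function using (_∘_; id)
  open import Relation.Binary.PropositionalEquality
  open ≡-Reasoning

  ∑ : ℕ → (ℕ → ℕ) → ℕ
  ∑ zero    f = 0
  ∑ (suc n) f = f 0 + ∑ n (λ i → f (suc i))

  ∑-cong : ∀ n {f g : ℕ → ℕ} → (∀ i → i < n → f i ≡ g i) → ∑ n f ≡ ∑ n g
  ∑-cong zero    f≗g = refl
  ∑-cong (suc n) f≗g = cong₂ _+_ (f≗g 0 (s≤s z≤n)) (∑-cong n (λ i i<n → f≗g (suc i) (s≤s i<n)))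

  ∑-+ : ∀ n (f g : ℕ → ℕ) → ∑ n (λ i → f i + g i) ≡ ∑ n f + ∑ n g
  ∑-+ zero    f g = refl
  ∑-+ (suc n) f g = trans (cong (f 0 + g 0 +_) (∑-+ n _ _)) (interchange (f 0) (g 0) _ _)
    where
    interchange : ∀ a b c d → a + b + (c + d) ≡ a + c + (b + d)
    interchange = solve-∀

  ∑-*ˡ : ∀ n k (f : ℕ → ℕ) → ∑ n (λ i → k * f i) ≡ k * ∑ n f
  ∑-*ˡ zero    k f = sym (*-zeroʳ k)
  ∑-*ˡ (suc n) k f = trans (cong (k * f 0 +_) (∑-*ˡ n k _)) (sym (*-distribˡ-+ k (f 0) _))

  ∑-zero : ∀ n (f : ℕ → ℕ) → (∀ i → i < n → f i ≡ 0) → ∑ n f ≡ 0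
  ∑-zero n f f≗0 = trans (∑-cong n f≗0) (∑-const-0 n)
    where
    ∑-const-0 : ∀ n → ∑ n (λ _ → 0) ≡ 0
    ∑-const-0 zero    = refl
    ∑-const-0 (suc n) = ∑-const-0 n

  ∑-init-last : ∀ n (f : ℕ → ℕ) → ∑ (suc n) f ≡ ∑ n f + f n
  ∑-init-last zero    f = +-comm (f 0) 0
  ∑-init-last (suc n) f = trans (cong (f 0 +_) (∑-init-last n _)) (sym (+-assoc (f 0) _ _))

  ∑-split : ∀ a d (f : ℕ → ℕ) → ∑ (a + d) f ≡ ∑ a f + ∑ d (λ i → f (a + i))
  ∑-split zero    d f = refl
  ∑-split (suc a) d f = trans (cong (f 0 +_) (∑-split a d _)) (sym (+-assoc (f 0) _ _))

  ∑-comm : ∀ a b (f : ℕ → ℕ → ℕ) → ∑ a (λ i → ∑ b (f i)) ≡ ∑ b (λ j → ∑ a (λ i → f i j))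
  ∑-comm zero    b f = sym (∑-zero b _ (λ _ _ → refl))
  ∑-comm (suc a) b f = trans (cong (∑ b (f 0) +_) (∑-comm a b _)) (sym (∑-+ b _ _))

  ∑-truncate : ∀ {k n} (f : ℕ → ℕ) → k ≤ n → (∀ i → k ≤ i → f i ≡ 0) → ∑ n f ≡ ∑ k f
  ∑-truncate {k} {n} f k≤n tail≡0 = begin
    ∑ n f                                 ≡⟨ cong (λ l → ∑ l f) (sym (m+[n∸m]≡n k≤n)) ⟩
    ∑ (k + (n ∸ k)) f                     ≡⟨ ∑-split k (n ∸ k) f ⟩
    ∑ k f + ∑ (n ∸ k) (λ i → f (k + i))
      ≡⟨ cong (∑ k f +_) (∑-zero (n ∸ k) _ (λ i _ → tail≡0 (k + i) (m≤m+n k i))) ⟩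
    ∑ k f + 0                             ≡⟨ +-identityʳ _ ⟩
    ∑ k f                                 ∎

  sumTo≡∑ : ∀ n f → sumTo n f ≡ ∑ (suc n) f
  sumTo≡∑ n f = go (suc n) id
    where
    go : ∀ k (g : ℕ → ℕ) → sum (map f (applyUpTo g k)) ≡ ∑ k (f ∘ g)
    go zero    g = refl
    go (suc k) g = cong (f (g 0) +_) (go k (g ∘ suc))

  -- Power series over ℕ, as coefficient sequences

  δ : ℕ → ℕ
  δ zero    = 1
  δ (suc _) = 0

  *-δ : ∀ n → n * δ n ≡ 0
  *-δ zero    = refl
  *-δ (suc n) = *-zeroʳ (suc n)

  infixl 7 _⋆_

  _⋆_ : (ℕ → ℕ) → (ℕ → ℕ) → ℕ → ℕ
  (a ⋆ b) n = ∑ (suc n) (λ i → a i * b (n ∸ i))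

  δ-⋆ : ∀ b n → (δ ⋆ b) n ≡ b n
  δ-⋆ b n = trans (cong₂ _+_ (+-identityʳ (b n)) (∑-zero n _ (λ _ _ → refl))) (+-identityʳ (b n))

  ⋆-distribʳ-+ : ∀ a b c n → ((λ i → a i + b i) ⋆ c) n ≡ (a ⋆ c) n + (b ⋆ c) n
  ⋆-distribʳ-+ a b c n =
    trans (∑-cong (suc n) (λ i _ → *-distribʳ-+ (c (n ∸ i)) (a i) (b i)))
          (∑-+ (suc n) (λ i → a i * c (n ∸ i)) (λ i → b i * c (n ∸ i)))

  ⋆-distribˡ-+ : ∀ a b c n → (a ⋆ (λ i → b i + c i)) n ≡ (a ⋆ b) n + (a ⋆ c) n
  ⋆-distribˡ-+ a b c n =
    trans (∑-cong (suc n) (λ i _ → *-distribˡ-+ (a i) (b (n ∸ i)) (c (n ∸ i))))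
          (∑-+ (suc n) (λ i → a i * b (n ∸ i)) (λ i → a i * c (n ∸ i)))

  ⋆-*ˡ : ∀ k a b n → ((λ i → k * a i) ⋆ b) n ≡ k * (a ⋆ b) n
  ⋆-*ˡ k a b n = trans (∑-cong (suc n) (λ i _ → *-assoc k (a i) (b (n ∸ i))))
                       (∑-*ˡ (suc n) k (λ i → a i * b (n ∸ i)))

  ⋆-*ʳ : ∀ k a b n → (a ⋆ (λ i → k * b i)) n ≡ k * (a ⋆ b) n
  ⋆-*ʳ k a b n = trans (∑-cong (suc n) (λ i _ → x*[k*y]≡k*[x*y] (a i) k (b (n ∸ i))))
                       (∑-*ˡ (suc n) k (λ i → a i * b (n ∸ i)))
    where
    x*[k*y]≡k*[x*y] : ∀ x k y → x * (k * y) ≡ k * (x * y)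
    x*[k*y]≡k*[x*y] = solve-∀

  -- Coefficientwise, α = (1 − x) a′.
  HasDerivative : (a α : ℕ → ℕ) → Set
  HasDerivative a α = ∀ n → suc n * a (suc n) ≡ n * a n + α n

  ⋆-weighted : ∀ a b n → n * (a ⋆ b) n ≡
    ∑ (suc n) (λ i → i * (a i * b (n ∸ i))) + ∑ (suc n) (λ i → a i * ((n ∸ i) * b (n ∸ i)))
  ⋆-weighted a b n = begin
    n * (a ⋆ b) n                                                 ≡⟨ sym (∑-*ˡ (suc n) n (λ i → a i * b (n ∸ i))) ⟩
    ∑ (suc n) (λ i → n * (a i * b (n ∸ i)))                       ≡⟨ ∑-cong (suc n) split ⟩
    ∑ (suc n) (λ i → i * (a i * b (n ∸ i)) + a i * ((n ∸ i) * b (n ∸ i)))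
      ≡⟨ ∑-+ (suc n) (λ i → i * (a i * b (n ∸ i))) (λ i → a i * ((n ∸ i) * b (n ∸ i))) ⟩
    _                                                             ∎
    where
    rearrange : ∀ i j x y → (i + j) * (x * y) ≡ i * (x * y) + x * (j * y)
    rearrange = solve-∀
    split : ∀ i → i < suc n → n * (a i * b (n ∸ i)) ≡ i * (a i * b (n ∸ i)) + a i * ((n ∸ i) * b (n ∸ i))
    split i (s≤s i≤n) = trans (cong (λ k → k * (a i * b (n ∸ i))) (sym (m+[n∸m]≡n i≤n)))
                              (rearrange i (n ∸ i) (a i) (b (n ∸ i)))

  ⋆-leibniz : ∀ {a b α β} → HasDerivative a α → HasDerivative b β →
              HasDerivative (a ⋆ b) (λ n → (α ⋆ b) n + (a ⋆ β) n)
  ⋆-leibniz {a} {b} {α} {β} a′ b′ n = begin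
    -- the term i = 0 of the first sum is 0 * … and drops out by computation
    suc n * (a ⋆ b) (suc n)                                        ≡⟨ ⋆-weighted a b (suc n) ⟩
    ∑ (suc n) (λ i → suc i * (a (suc i) * b (n ∸ i))) + ∑ (suc (suc n)) right
                                                                   ≡⟨ cong₂ _+_ left-part right-part ⟩
    (X + (α ⋆ b) n) + (Y + (a ⋆ β) n)                              ≡⟨ regroup X Y _ _ ⟩
    (X + Y) + ((α ⋆ b) n + (a ⋆ β) n)
      ≡⟨ cong (_+ ((α ⋆ b) n + (a ⋆ β) n)) (sym (⋆-weighted a b n)) ⟩
    n * (a ⋆ b) n + ((α ⋆ b) n + (a ⋆ β) n)                        ∎
    where
    X = ∑ (suc n) (λ i → i * (a i * b (n ∸ i)))
    Y = ∑ (suc n) (λ i → a i * ((n ∸ i) * b (n ∸ i)))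
    right : ℕ → ℕ
    right i = a i * ((suc n ∸ i) * b (suc n ∸ i))
    regroup : ∀ x y p q → (x + p) + (y + q) ≡ (x + y) + (p + q)
    regroup = solve-∀
    left-part : ∑ (suc n) (λ i → suc i * (a (suc i) * b (n ∸ i))) ≡ X + (α ⋆ b) n
    left-part = begin
      ∑ (suc n) (λ i → suc i * (a (suc i) * b (n ∸ i)))
        ≡⟨ ∑-cong (suc n) (λ i _ → trans (sym (*-assoc (suc i) (a (suc i)) (b (n ∸ i))))
                                         (cong (_* b (n ∸ i)) (a′ i))) ⟩
      ∑ (suc n) (λ i → (i * a i + α i) * b (n ∸ i))
        ≡⟨ ∑-cong (suc n) (λ i _ → trans (*-distribʳ-+ (b (n ∸ i)) (i * a i) (α i))
                                         (cong (_+ α i * b (n ∸ i)) (*-assoc i (a i) (b (n ∸ i))))) ⟩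
      ∑ (suc n) (λ i → i * (a i * b (n ∸ i)) + α i * b (n ∸ i))
        ≡⟨ ∑-+ (suc n) (λ i → i * (a i * b (n ∸ i))) (λ i → α i * b (n ∸ i)) ⟩
      X + (α ⋆ b) n ∎
    right-part : ∑ (suc (suc n)) right ≡ Y + (a ⋆ β) n
    right-part = begin
      ∑ (suc (suc n)) right
        ≡⟨ ∑-init-last (suc n) right ⟩
      ∑ (suc n) right + a (suc n) * ((suc n ∸ suc n) * b (suc n ∸ suc n))
        ≡⟨ cong (λ k → ∑ (suc n) right + a (suc n) * (k * b k)) (n∸n≡0 n) ⟩
      ∑ (suc n) right + a (suc n) * 0
        ≡⟨ trans (cong (∑ (suc n) right +_) (*-zeroʳ (a (suc n)))) (+-identityʳ _) ⟩
      ∑ (suc n) right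
        ≡⟨ ∑-cong (suc n) shift ⟩
      ∑ (suc n) (λ i → a i * ((n ∸ i) * b (n ∸ i)) + a i * β (n ∸ i))
        ≡⟨ ∑-+ (suc n) (λ i → a i * ((n ∸ i) * b (n ∸ i))) (λ i → a i * β (n ∸ i)) ⟩
      Y + (a ⋆ β) n ∎
      where
      shift : ∀ i → i < suc n → right i ≡ a i * ((n ∸ i) * b (n ∸ i)) + a i * β (n ∸ i)
      shift i (s≤s i≤n) = begin
        a i * ((suc n ∸ i) * b (suc n ∸ i))     ≡⟨ cong (λ k → a i * (k * b k)) (+-∸-assoc 1 i≤n) ⟩
        a i * (suc (n ∸ i) * b (suc (n ∸ i)))   ≡⟨ cong (a i *_) (b′ (n ∸ i)) ⟩
        a i * ((n ∸ i) * b (n ∸ i) + β (n ∸ i)) ≡⟨ *-distribˡ-+ (a i) _ _ ⟩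
        _                                       ∎

  HasDerivative-cong : ∀ {a α β} → (∀ n → α n ≡ β n) → HasDerivative a α → HasDerivative a β
  HasDerivative-cong α≗β a′ n = trans (a′ n) (cong (_ +_) (α≗β n))

  weakCompositions : ℕ → ℕ → ℕ
  weakCompositions zero    zero    = 1
  weakCompositions zero    (suc i) = 0
  weakCompositions (suc k) zero    = 1
  weakCompositions (suc k) (suc i) = weakCompositions (suc k) i + weakCompositions k (suc i)

  weakCompositions-into-1 : ∀ i → weakCompositions 1 i ≡ 1
  weakCompositions-into-1 zero    = refl
  weakCompositions-into-1 (suc i) = trans (+-identityʳ _) (weakCompositions-into-1 i)

  weakCompositions-factorial : ∀ k i → weakCompositions (suc k) i * (i ! * k !) ≡ (i + k) !
  weakCompositions-factorial k zero = trans (*-identityˡ _) (+-identityʳ (k !))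
  weakCompositions-factorial zero (suc i) = begin
    weakCompositions 1 (suc i) * (suc i ! * 1) ≡⟨ cong (_* (suc i ! * 1)) (weakCompositions-into-1 (suc i)) ⟩
    1 * (suc i ! * 1)                          ≡⟨ trans (*-identityˡ _) (*-identityʳ _) ⟩
    suc i !                                    ≡⟨ cong _! (sym (+-identityʳ (suc i))) ⟩
    (suc i + 0) !                              ∎
  weakCompositions-factorial (suc k) (suc i) = begin
    (W (suc (suc k)) i + W (suc k) (suc i)) * (suc i ! * suc k !)
      ≡⟨ pascal (W (suc (suc k)) i) (W (suc k) (suc i)) i k (i !) (k !) ⟩
    suc i * (W (suc (suc k)) i * (i ! * suc k !)) + suc k * (W (suc k) (suc i) * (suc i ! * k !))
      ≡⟨ cong₂ (λ x y → suc i * x + suc k * y) (weakCompositions-factorial (suc k) i)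
                                               (weakCompositions-factorial k (suc i)) ⟩
    suc i * (i + suc k) ! + suc k * (suc i + k) !
      ≡⟨ cong (λ x → suc i * x ! + suc k * (suc i + k) !) (+-suc i k) ⟩
    suc i * (suc i + k) ! + suc k * (suc i + k) !
      ≡⟨ sym (*-distribʳ-+ ((suc i + k) !) (suc i) (suc k)) ⟩
    (suc i + suc k) * (suc i + k) !
      ≡⟨ cong (λ x → (suc i + suc k) * x !) (sym (+-suc i k)) ⟩
    (suc i + suc k) ! ∎
    where
    W = weakCompositions
    pascal : ∀ a b i k fi fk → (a + b) * ((fi + i * fi) * (fk + k * fk))
           ≡ (1 + i) * (a * (fi * (fk + k * fk))) + (1 + k) * (b * ((fi + i * fi) * fk))
    pascal = solve-∀

  weakCompositions-suc : ∀ k i → suc i * weakCompositions k (suc i) ≡ (i + k) * weakCompositions k i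
  weakCompositions-suc zero zero    = refl
  weakCompositions-suc zero (suc i) = trans (*-zeroʳ (suc (suc i))) (sym (*-zeroʳ (suc i + 0)))
  weakCompositions-suc (suc k) i = *-cancelʳ-≡ _ _ (i ! * k !) {{i !* k !≢0}} (begin
    suc i * W (suc i) * (i ! * k !)       ≡⟨ regroup (suc i) (W (suc i)) (i !) (k !) ⟩
    W (suc i) * (suc i ! * k !)           ≡⟨ weakCompositions-factorial k (suc i) ⟩
    suc (i + k) * (i + k) !               ≡⟨ cong₂ _*_ (sym (+-suc i k)) (sym (weakCompositions-factorial k i)) ⟩
    (i + suc k) * (W i * (i ! * k !))     ≡⟨ sym (*-assoc (i + suc k) _ _) ⟩
    (i + suc k) * W i * (i ! * k !)       ∎)
    where
    W = weakCompositions (suc k)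
    regroup : ∀ a b c d → a * b * (c * d) ≡ b * (a * c * d)
    regroup = solve-∀

  weakCompositions-of-1 : ∀ k → weakCompositions k 1 ≡ k
  weakCompositions-of-1 k = begin
    weakCompositions k 1         ≡⟨ sym (*-identityˡ _) ⟩
    1 * weakCompositions k 1     ≡⟨ weakCompositions-suc k 0 ⟩
    k * weakCompositions k 0     ≡⟨ cong (k *_) (weakCompositions-of-0 k) ⟩
    k * 1                        ≡⟨ *-identityʳ k ⟩
    k                            ∎
    where
    weakCompositions-of-0 : ∀ k → weakCompositions k 0 ≡ 1
    weakCompositions-of-0 zero    = refl
    weakCompositions-of-0 (suc k) = refl

  module MatrixCount (m : ℕ) where

    nonzeroColumns : ℕ → ℕ
    nonzeroColumns zero    = 0
    nonzeroColumns (suc i) = weakCompositions m (suc i)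

    -- matrices j n: m × j matrices of naturals with entry sum n and no zero column
    matrices : ℕ → ℕ → ℕ
    matrices zero    = δ
    matrices (suc j) = nonzeroColumns ⋆ matrices j

    nonzeroColumns′ : HasDerivative nonzeroColumns (λ i → m * (nonzeroColumns i + δ i))
    nonzeroColumns′ zero = begin
      1 * weakCompositions m 1 ≡⟨ *-identityˡ _ ⟩
      weakCompositions m 1     ≡⟨ weakCompositions-of-1 m ⟩
      m                        ≡⟨ sym (*-identityʳ m) ⟩
      m * 1                    ∎
    nonzeroColumns′ (suc i) = begin
      suc (suc i) * weakCompositions m (suc (suc i))  ≡⟨ weakCompositions-suc m (suc i) ⟩
      (suc i + m) * nonzeroColumns (suc i)             ≡⟨ *-distribʳ-+ _ (suc i) m ⟩
      suc i * nonzeroColumns (suc i) + m * nonzeroColumns (suc i)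
        ≡⟨ cong (λ x → suc i * nonzeroColumns (suc i) + m * x) (sym (+-identityʳ _)) ⟩
      suc i * nonzeroColumns (suc i) + m * (nonzeroColumns (suc i) + 0) ∎

    -- (1 − x)(Cʲ)′ = j m (Cʲ + Cʲ⁻¹); at j = 0 the factor j hides the junk term matrices (pred 0).
    matrices′ : ∀ j → HasDerivative (matrices j) (λ n → j * m * (matrices j n + matrices (pred j) n))
    matrices′ zero n = trans (*-zeroʳ (suc n)) (sym (trans (+-identityʳ _) (*-δ n)))
    matrices′ (suc j) = HasDerivative-cong collect (⋆-leibniz nonzeroColumns′ (matrices′ j))
      where
      shifted : ∀ j n → j * m * (nonzeroColumns ⋆ matrices (pred j)) n ≡ j * m * matrices j n
      shifted zero    n = refl
      shifted (suc j) n = refl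
      N = matrices
      c = nonzeroColumns
      collect : ∀ n → ((λ i → m * (c i + δ i)) ⋆ N j) n + (c ⋆ (λ i → j * m * (N j i + N (pred j) i))) n
                    ≡ suc j * m * (N (suc j) n + N j n)
      collect n = begin
        ((λ i → m * (c i + δ i)) ⋆ N j) n + (c ⋆ (λ i → j * m * (N j i + N (pred j) i))) n
          ≡⟨ cong₂ _+_ (⋆-*ˡ m (λ i → c i + δ i) (N j) n) (⋆-*ʳ (j * m) c (λ i → N j i + N (pred j) i) n) ⟩
        m * ((λ i → c i + δ i) ⋆ N j) n + j * m * (c ⋆ (λ i → N j i + N (pred j) i)) n
          ≡⟨ cong₂ (λ x y → m * x + j * m * y) (trans (⋆-distribʳ-+ c δ (N j) n) (cong (N (suc j) n +_) (δ-⋆ (N j) n)))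
                                               (⋆-distribˡ-+ c (N j) (N (pred j)) n) ⟩
        m * (N (suc j) n + N j n) + j * m * (N (suc j) n + (c ⋆ N (pred j)) n)
          ≡⟨ cong (m * (N (suc j) n + N j n) +_) (trans (*-distribˡ-+ (j * m) _ _)
                   (trans (cong (j * m * N (suc j) n +_) (shifted j n)) (sym (*-distribˡ-+ (j * m) _ _)))) ⟩
        m * (N (suc j) n + N j n) + j * m * (N (suc j) n + N j n)
          ≡⟨ sym (*-distribʳ-+ (N (suc j) n + N j n) m (j * m)) ⟩
        suc j * m * (N (suc j) n + N j n) ∎

    record SatisfiesRecurrence (T : ℕ → ℕ → ℕ) : Set where
      field
        first-column : ∀ n → T 0 n ≡ δ n
        first-row    : ∀ j → T (suc j) 0 ≡ 0
        step         : ∀ j n → T (suc j) (suc n) ≡ n * T (suc j) n + suc j * m * (T (suc j) n + T j n)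

    recurrence-unique : ∀ {S T} → SatisfiesRecurrence S → SatisfiesRecurrence T → ∀ j n → S j n ≡ T j n
    recurrence-unique {S} {T} S-rec T-rec = go
      where
      module S = SatisfiesRecurrence S-rec
      module T = SatisfiesRecurrence T-rec
      go : ∀ j n → S j n ≡ T j n
      go zero    n       = trans (S.first-column n) (sym (T.first-column n))
      go (suc j) zero    = trans (S.first-row j) (sym (T.first-row j))
      go (suc j) (suc n) = begin
        S (suc j) (suc n)                                     ≡⟨ S.step j n ⟩
        n * S (suc j) n + suc j * m * (S (suc j) n + S j n)   ≡⟨ cong₂ (λ x y → n * x + suc j * m * (x + y))
                                                                       (go (suc j) n) (go j n) ⟩
        n * T (suc j) n + suc j * m * (T (suc j) n + T j n)   ≡⟨ sym (T.step j n) ⟩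
        T (suc j) (suc n)                                     ∎

    factorial-matrices-recurrence : SatisfiesRecurrence (λ j n → n ! * matrices j n)
    factorial-matrices-recurrence = record
      { first-column = λ { zero → refl ; (suc n) → *-zeroʳ (suc n !) }
      ; first-row    = λ _ → refl
      ; step         = λ j n → begin
          suc n ! * matrices (suc j) (suc n)            ≡⟨ regroup (suc n) (n !) (matrices (suc j) (suc n)) ⟩
          n ! * (suc n * matrices (suc j) (suc n))      ≡⟨ cong (n ! *_) (matrices′ (suc j) n) ⟩
          n ! * (n * matrices (suc j) n + suc j * m * (matrices (suc j) n + matrices j n))
            ≡⟨ distribute (n !) n (suc j * m) (matrices (suc j) n) (matrices j n) ⟩
          n * (n ! * matrices (suc j) n) + suc j * m * (n ! * matrices (suc j) n + n ! * matrices j n) ∎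
      }
      where
      regroup : ∀ a f x → (a * f) * x ≡ f * (a * x)
      regroup = solve-∀
      distribute : ∀ f n k a b → f * (n * a + k * (a + b)) ≡ n * (f * a) + k * (f * a + f * b)
      distribute = solve-∀

  stirling1-vanishes : ∀ n k → n < k → stirling1 n k ≡ 0
  stirling1-vanishes zero    (suc k) _         = refl
  stirling1-vanishes (suc n) (suc k) (s≤s n<k) =
    cong₂ _+_ (trans (cong (n *_) (stirling1-vanishes n (suc k) (m≤n⇒m≤1+n n<k))) (*-zeroʳ n))
              (stirling1-vanishes n k n<k)

  stirling2-vanishes : ∀ k j → k < j → stirling2 k j ≡ 0
  stirling2-vanishes zero    (suc j) _         = refl
  stirling2-vanishes (suc k) (suc j) (s≤s k<j) =
    cong₂ _+_ (trans (cong (suc j *_) (stirling2-vanishes k (suc j) (m≤n⇒m≤1+n k<j))) (*-zeroʳ (suc j)))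
              (stirling2-vanishes k j k<j)

  stirling1-zero : ∀ n → stirling1 n 0 ≡ δ n
  stirling1-zero zero    = refl
  stirling1-zero (suc n) = refl

  module StirlingSum (m : ℕ) where
    open MatrixCount m

    stirlingSum : ℕ → ℕ → ℕ
    stirlingSum j n = ∑ (suc n) (λ k → stirling1 n k * stirling2 k j * m ^ k)

    stirlingSum-zero : ∀ n → stirlingSum 0 n ≡ δ n
    stirlingSum-zero n =
      trans (cong₂ _+_ (trans (*-identityʳ _) (trans (*-identityʳ _) (stirling1-zero n)))
                       (∑-zero n (λ k → stirling1 n (suc k) * 0 * m ^ suc k)
                                 (λ k _ → cong (_* m ^ suc k) (*-zeroʳ (stirling1 n (suc k))))))
            (+-identityʳ (δ n))

    stirlingSum-step : ∀ j n → stirlingSum (suc j) (suc n)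
                     ≡ n * stirlingSum (suc j) n + (suc j * m * stirlingSum (suc j) n + m * stirlingSum j n)
    stirlingSum-step j n = begin
      ∑ (suc n) (λ k → (n * stirling1 n (suc k) + stirling1 n k) * stirling2 (suc k) (suc j) * m ^ suc k)
        ≡⟨ ∑-cong (suc n) (λ k _ → expand n (stirling1 n (suc k)) (stirling1 n k) (suc j)
                                           (stirling2 k (suc j)) (stirling2 k j) m (m ^ k)) ⟩
      ∑ (suc n) (λ k → n * g (suc k) + (suc j * m * g k + m * g′ k))
        ≡⟨ trans (∑-+ (suc n) (λ k → n * g (suc k)) (λ k → suc j * m * g k + m * g′ k))
                 (cong (∑ (suc n) (λ k → n * g (suc k)) +_) (∑-+ (suc n) (λ k → suc j * m * g k) (λ k → m * g′ k))) ⟩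
      ∑ (suc n) (λ k → n * g (suc k)) + (∑ (suc n) (λ k → suc j * m * g k) + ∑ (suc n) (λ k → m * g′ k))
        ≡⟨ cong₂ _+_ (trans (∑-*ˡ (suc n) n (λ k → g (suc k))) (cong (n *_) shift))
                     (cong₂ _+_ (∑-*ˡ (suc n) (suc j * m) g) (∑-*ˡ (suc n) m g′)) ⟩
      n * stirlingSum (suc j) n + (suc j * m * stirlingSum (suc j) n + m * stirlingSum j n) ∎
      where
      g g′ : ℕ → ℕ
      g  k = stirling1 n k * stirling2 k (suc j) * m ^ k
      g′ k = stirling1 n k * stirling2 k j * m ^ k
      expand : ∀ n a b j x y m p → (n * a + b) * (j * x + y) * (m * p)
             ≡ n * (a * (j * x + y) * (m * p)) + (j * m * (b * x * p) + m * (b * y * p))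
      expand = solve-∀
      shift : ∑ (suc n) (λ k → g (suc k)) ≡ stirlingSum (suc j) n
      shift = begin
        ∑ (suc n) (λ k → g (suc k))          ≡⟨ cong (_+ ∑ (suc n) (λ k → g (suc k))) (sym g0≡0) ⟩
        ∑ (suc (suc n)) g                    ≡⟨ ∑-init-last (suc n) g ⟩
        ∑ (suc n) g + g (suc n)              ≡⟨ cong (∑ (suc n) g +_) gn≡0 ⟩
        ∑ (suc n) g + 0                      ≡⟨ +-identityʳ _ ⟩
        ∑ (suc n) g                          ∎
        where
        g0≡0 : g 0 ≡ 0
        g0≡0 = cong (_* 1) (*-zeroʳ (stirling1 n 0))
        gn≡0 : g (suc n) ≡ 0
        gn≡0 = cong (λ x → x * stirling2 (suc n) (suc j) * m ^ suc n) (stirling1-vanishes n (suc n) ≤-refl)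

    stirlingSum-recurrence : SatisfiesRecurrence (λ j n → j ! * stirlingSum j n)
    stirlingSum-recurrence = record
      { first-column = λ n → trans (*-identityˡ _) (stirlingSum-zero n)
      ; first-row    = λ j → *-zeroʳ (suc j !)
      ; step         = λ j n → trans (cong (suc j ! *_) (stirlingSum-step j n))
                                     (distribute n (suc j) m (stirlingSum (suc j) n) (stirlingSum j n) (j !))
      }
      where
      distribute : ∀ n j m q q′ f → (j * f) * (n * q + (j * m * q + m * q′))
                 ≡ n * ((j * f) * q) + j * m * ((j * f) * q + f * q′)
      distribute = solve-∀

    -- The summand vanishes unless j ≤ k, and k ≤ n, so the inner sum over j is fub k.
    factorial-∑matrices : ∀ n → n ! * ∑ (suc n) (λ j → matrices j n)
                                ≡ sumTo n (λ k → stirling1 n k * m ^ k * fub k)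
    factorial-∑matrices n = begin
      n ! * ∑ (suc n) (λ j → matrices j n)
        ≡⟨ sym (∑-*ˡ (suc n) (n !) (λ j → matrices j n)) ⟩
      ∑ (suc n) (λ j → n ! * matrices j n)
        ≡⟨ ∑-cong (suc n) (λ j _ → recurrence-unique factorial-matrices-recurrence stirlingSum-recurrence j n) ⟩
      ∑ (suc n) (λ j → j ! * stirlingSum j n)
        ≡⟨ ∑-cong (suc n) (λ j _ → sym (∑-*ˡ (suc n) (j !) (λ k → stirling1 n k * stirling2 k j * m ^ k))) ⟩
      ∑ (suc n) (λ j → ∑ (suc n) (λ k → t k j))
        ≡⟨ ∑-comm (suc n) (suc n) (λ j k → t k j) ⟩
      ∑ (suc n) (λ k → ∑ (suc n) (λ j → t k j))
        ≡⟨ ∑-cong (suc n) inner ⟩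
      ∑ (suc n) (λ k → stirling1 n k * m ^ k * fub k)
        ≡⟨ sym (sumTo≡∑ n _) ⟩
      sumTo n (λ k → stirling1 n k * m ^ k * fub k) ∎
      where
      t : ℕ → ℕ → ℕ
      t k j = j ! * (stirling1 n k * stirling2 k j * m ^ k)
      regroup : ∀ f a b p → f * (a * b * p) ≡ a * p * (f * b)
      regroup = solve-∀
      inner : ∀ k → k < suc n → ∑ (suc n) (t k) ≡ stirling1 n k * m ^ k * fub k
      inner k k<1+n = begin
        ∑ (suc n) (t k)
          ≡⟨ ∑-cong (suc n) (λ j _ → regroup (j !) (stirling1 n k) (stirling2 k j) (m ^ k)) ⟩
        ∑ (suc n) (λ j → stirling1 n k * m ^ k * (j ! * stirling2 k j))
          ≡⟨ ∑-*ˡ (suc n) (stirling1 n k * m ^ k) (λ j → j ! * stirling2 k j) ⟩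
        stirling1 n k * m ^ k * ∑ (suc n) (λ j → j ! * stirling2 k j)
          ≡⟨ cong (stirling1 n k * m ^ k *_) (∑-truncate (λ j → j ! * stirling2 k j) k<1+n vanish) ⟩
        stirling1 n k * m ^ k * ∑ (suc k) (λ j → j ! * stirling2 k j)
          ≡⟨ cong (stirling1 n k * m ^ k *_) (sym (sumTo≡∑ k _)) ⟩
        stirling1 n k * m ^ k * fub k ∎
        where
        vanish : ∀ j → suc k ≤ j → j ! * stirling2 k j ≡ 0
        vanish j k<j = trans (cong (j ! *_) (stirling2-vanishes k j k<j)) (*-zeroʳ (j !))

module Matrices where

  open import Defs using (G; Perm; Distinct; columnWord)
  open import Data.Nat using (ℕ; zero; suc; _+_; _*_; _∸_; _≤_; _<_; z≤n; s≤s)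
  open import Data.Nat.Properties
  open import Data.Nat.ListAction using (sum)
  open import Data.Fin using (Fin; zero; suc)
  open import Data.Fin.Properties using (+↔⊎; *↔×)
  import Data.Fin.Properties as Finₚ
  open import Data.List using (List; []; _∷_; length; _++_; concat; map; take; drop; allFin)
  open import Data.List.Properties
    using (length-take; length-drop; take++drop≡id; length-++; ++-assoc; ++-identityʳ; length-tabulate)
  import Data.List.Properties as List
  open import Data.List.Relation.Unary.All as All using (All; []; _∷_)
  open import Data.Vec as Vec using (Vec; []; _∷_; toList; fromList; replicate)
  open import Data.Vec.Properties using (toList∘fromList)
  import Data.Vec.Relation.Unary.All as VecAll
  import Data.Vec.Relation.Unary.All.Properties as VecAll
  open import Data.Product using (Σ; _×_; _,_; proj₁; proj₂)
  open import Data.Sum using (_⊎_; inj₁; inj₂)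
  open import Data.Empty using (⊥-elim)
  open import Relation.Nullary using (¬_)
  open import Data.Bool.Properties using (T-irrelevant)
  open import Function.Bundles using (_↔_; mk↔ₛ′)
  open import Function.Properties.Inverse using (↔-sym; ↔-trans)
  open import Data.Sum.Function.Propositional using (_⊎-↔_)
  open import Data.Product.Function.NonDependent.Propositional using (_×-↔_)
  open import Axiom.UniquenessOfIdentityProofs using (module Decidable⇒UIP)
  open import Relation.Binary.PropositionalEquality
  open Counting

  infixr 2 _⟨↔⟩_
  _⟨↔⟩_ : ∀ {a b c} {A : Set a} {B : Set b} {C : Set c} → A ↔ B → B ↔ C → A ↔ C
  _⟨↔⟩_ = ↔-trans

  ×↔Fin* : ∀ {A B : Set} {a b} → A ↔ Fin a → B ↔ Fin b → (A × B) ↔ Fin (a * b)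
  ×↔Fin* A↔a B↔b = (A↔a ×-↔ B↔b) ⟨↔⟩ ↔-sym *↔×

  ⊎↔Fin+ : ∀ {A B : Set} {a b} → A ↔ Fin a → B ↔ Fin b → (A ⊎ B) ↔ Fin (a + b)
  ⊎↔Fin+ A↔a B↔b = (A↔a ⊎-↔ B↔b) ⟨↔⟩ ↔-sym +↔⊎

  Σ<↔Fin∑ : ∀ k (F : ℕ → Set) (f : ℕ → ℕ) → (∀ i → i < k → F i ↔ Fin (f i)) →
            Σ ℕ (λ i → i < k × F i) ↔ Fin (∑ k f)
  Σ<↔Fin∑ zero    F f F↔f = mk↔ₛ′ (λ { (_ , () , _) }) (λ ()) (λ ()) (λ { (_ , () , _) })
  Σ<↔Fin∑ (suc k) F f F↔f =
    mk↔ₛ′ split join split∘join join∘split ⟨↔⟩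
    ⊎↔Fin+ (F↔f 0 (s≤s z≤n))
           (Σ<↔Fin∑ k (λ i → F (suc i)) (λ i → f (suc i)) (λ i i<k → F↔f (suc i) (s≤s i<k)))
    where
    split : Σ ℕ (λ i → i < suc k × F i) → F 0 ⊎ Σ ℕ (λ i → i < k × F (suc i))
    split (zero  , _       , x) = inj₁ x
    split (suc i , s≤s i<k , x) = inj₂ (i , i<k , x)
    join : F 0 ⊎ Σ ℕ (λ i → i < k × F (suc i)) → Σ ℕ (λ i → i < suc k × F i)
    join (inj₁ x)             = zero , s≤s z≤n , x
    join (inj₂ (i , i<k , x)) = suc i , s≤s i<k , x
    split∘join : ∀ y → split (join y) ≡ y
    split∘join (inj₁ x) = refl
    split∘join (inj₂ y) = refl
    join∘split : ∀ x → join (split x) ≡ x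
    join∘split (zero  , s≤s z≤n , x) = refl
    join∘split (suc i , s≤s i<k , x) = refl

  Σ-≡-irrelevant : ∀ {A : Set} {P : A → Set} → (∀ {a} (p q : P a) → p ≡ q) →
                   ∀ {a b p q} → a ≡ b → _≡_ {A = Σ A P} (a , p) (b , q)
  Σ-≡-irrelevant irr {p = p} {q} refl = cong (_ ,_) (irr p q)

  -- Shapes: matrices of naturals, as lists of columns

  WeakComposition : ℕ → ℕ → Set
  WeakComposition k i = Σ (Vec ℕ k) (λ v → Vec.sum v ≡ i)

  WeakComposition↔Fin : ∀ k i → WeakComposition k i ↔ Fin (weakCompositions k i)
  WeakComposition↔Fin zero zero =
    mk↔ₛ′ (λ _ → zero) (λ _ → [] , refl) (λ { zero → refl }) (λ { ([] , refl) → refl })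
  WeakComposition↔Fin zero (suc i) = mk↔ₛ′ (λ { ([] , ()) }) (λ ()) (λ ()) (λ { ([] , ()) })
  WeakComposition↔Fin (suc k) zero =
    mk↔ₛ′ (λ _ → zero) (λ _ → replicate _ 0 , sum-zeros k) (λ { zero → refl }) unique
    where
    sum-zeros : ∀ k → Vec.sum (replicate k 0) ≡ 0
    sum-zeros zero    = refl
    sum-zeros (suc k) = sum-zeros k
    sum≡0⇒zeros : ∀ {k} (v : Vec ℕ k) → Vec.sum v ≡ 0 → replicate k 0 ≡ v
    sum≡0⇒zeros []         _   = refl
    sum≡0⇒zeros (zero ∷ v) v≡0 = cong (0 ∷_) (sum≡0⇒zeros v v≡0)
    unique : ∀ {k} (x : WeakComposition k 0) → (replicate k 0 , sum-zeros k) ≡ x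
    unique (v , v≡0) = Σ-≡-irrelevant ≡-irrelevant (sum≡0⇒zeros v v≡0)
  WeakComposition↔Fin (suc k) (suc i) =
    mk↔ₛ′ split join split∘join join∘split ⟨↔⟩
    ⊎↔Fin+ (WeakComposition↔Fin (suc k) i) (WeakComposition↔Fin k (suc i))
    where
    split : WeakComposition (suc k) (suc i) → WeakComposition (suc k) i ⊎ WeakComposition k (suc i)
    split (zero  ∷ v , e) = inj₂ (v , e)
    split (suc x ∷ v , e) = inj₁ (x ∷ v , suc-injective e)
    join : WeakComposition (suc k) i ⊎ WeakComposition k (suc i) → WeakComposition (suc k) (suc i)
    join (inj₁ (x ∷ v , e)) = suc x ∷ v , cong suc e
    join (inj₂ (v , e))     = zero ∷ v , e
    split∘join : ∀ y → split (join y) ≡ y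
    split∘join (inj₁ (x ∷ v , refl)) = refl
    split∘join (inj₂ (v , e))        = refl
    join∘split : ∀ x → join (split x) ≡ x
    join∘split (zero  ∷ v , e)    = refl
    join∘split (suc x ∷ v , refl) = refl

  Nonzero : ∀ {k} → Vec ℕ k → Set
  Nonzero v = 1 ≤ Vec.sum v

  total : ∀ {k} → List (Vec ℕ k) → ℕ
  total s = sum (map Vec.sum s)

  module ShapeCount (m : ℕ) where
    open MatrixCount m

    NonzeroColumn : ℕ → Set
    NonzeroColumn i = Σ (Vec ℕ m) (λ v → Vec.sum v ≡ i × Nonzero v)

    NonzeroColumn↔Fin : ∀ i → NonzeroColumn i ↔ Fin (nonzeroColumns i)
    NonzeroColumn↔Fin zero = mk↔ₛ′ (λ { (v , e , v≢0) → ⊥-elim (sum≡0⇒zero v e v≢0) }) (λ ()) (λ ())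
                                   (λ { (v , e , v≢0) → ⊥-elim (sum≡0⇒zero v e v≢0) })
      where
      sum≡0⇒zero : ∀ (v : Vec ℕ m) → Vec.sum v ≡ 0 → ¬ Nonzero v
      sum≡0⇒zero v e v≢0 with () ← subst (1 ≤_) e v≢0
    NonzeroColumn↔Fin (suc i) =
      mk↔ₛ′ (λ { (v , e , _) → v , e }) (λ { (v , e) → v , e , subst (1 ≤_) (sym e) (s≤s z≤n) })
            (λ _ → refl) (λ { (v , e , _) → cong (λ p → v , e , p) (≤-irrelevant _ _) })
      ⟨↔⟩ WeakComposition↔Fin m (suc i)

    ShapeWith : ℕ → ℕ → Set
    ShapeWith j n = Σ (List (Vec ℕ m)) (λ s → length s ≡ j × total s ≡ n × All Nonzero s)

    Shape : ℕ → Set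
    Shape n = Σ (List (Vec ℕ m)) (λ s → total s ≡ n × All Nonzero s)

    ShapeWith↔Fin : ∀ j n → ShapeWith j n ↔ Fin (matrices j n)
    ShapeWith↔Fin zero zero =
      mk↔ₛ′ (λ _ → zero) (λ _ → [] , refl , refl , [])
            (λ { zero → refl }) (λ { ([] , refl , refl , []) → refl })
    ShapeWith↔Fin zero (suc n) = mk↔ₛ′ (λ { ([] , _ , () , _) }) (λ ()) (λ ()) (λ { ([] , _ , () , _) })
    ShapeWith↔Fin (suc j) n =
      mk↔ₛ′ split join split∘join join∘split ⟨↔⟩
      Σ<↔Fin∑ (suc n) (λ i → NonzeroColumn i × ShapeWith j (n ∸ i)) (λ i → nonzeroColumns i * matrices j (n ∸ i))
              (λ i _ → ×↔Fin* (NonzeroColumn↔Fin i) (ShapeWith↔Fin j (n ∸ i)))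
      where
      Split = Σ ℕ (λ i → i < suc n × (NonzeroColumn i × ShapeWith j (n ∸ i)))
      split : ShapeWith (suc j) n → Split
      split (v ∷ s , refl , e , v≢0 ∷ s≢0) =
        Vec.sum v , s≤s (subst (Vec.sum v ≤_) e (m≤m+n (Vec.sum v) (total s))) ,
        (v , refl , v≢0) , (s , refl , trans (sym (m+n∸m≡n (Vec.sum v) (total s))) (cong (_∸ Vec.sum v) e) , s≢0)
      join : Split → ShapeWith (suc j) n
      join (i , s≤s i≤n , (v , ev , v≢0) , (s , l , e , s≢0)) =
        v ∷ s , cong suc l , trans (cong₂ _+_ ev e) (m+[n∸m]≡n i≤n) , v≢0 ∷ s≢0
      split∘join : ∀ y → split (join y) ≡ y
      split∘join (i , s≤s i≤n , (v , refl , v≢0) , (s , refl , e , s≢0))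
        with trans (cong₂ _+_ refl e) (m+[n∸m]≡n i≤n)
      ... | refl = cong₂ (λ p q → Vec.sum v , p , (v , refl , v≢0) , (s , refl , q , s≢0))
                         (≤-irrelevant _ _) (≡-irrelevant _ _)
      join∘split : ∀ x → join (split x) ≡ x
      join∘split (v ∷ s , refl , refl , v≢0 ∷ s≢0) =
        cong (λ e → v ∷ s , refl , e , v≢0 ∷ s≢0) (≡-irrelevant _ _)

    length≤total : ∀ (s : List (Vec ℕ m)) → All Nonzero s → length s ≤ total s
    length≤total []      []           = z≤n
    length≤total (v ∷ s) (v≢0 ∷ s≢0) = +-mono-≤ v≢0 (length≤total s s≢0)

    Shape↔Fin : ∀ n → Shape n ↔ Fin (∑ (suc n) (λ j → matrices j n))
    Shape↔Fin n =
      mk↔ₛ′ split join split∘join (λ _ → refl) ⟨↔⟩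
      Σ<↔Fin∑ (suc n) (λ j → ShapeWith j n) (λ j → matrices j n) (λ j _ → ShapeWith↔Fin j n)
      where
      split : Shape n → Σ ℕ (λ j → j < suc n × ShapeWith j n)
      split (s , e , s≢0) = length s , s≤s (subst (length s ≤_) e (length≤total s s≢0)) , (s , refl , e , s≢0)
      join : Σ ℕ (λ j → j < suc n × ShapeWith j n) → Shape n
      join (_ , _ , (s , _ , e , s≢0)) = s , e , s≢0
      split∘join : ∀ y → split (join y) ≡ y
      split∘join (j , _ , (s , refl , e , s≢0)) = cong (λ p → length s , p , (s , refl , e , s≢0)) (≤-irrelevant _ _)

  -- A matrix of words is determined by its shape and its reading word

  module Fill {X : Set} where

    columnWord′ : ∀ {k} → Vec (List X) k → List X
    columnWord′ col = concat (toList col)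

    word : ∀ {k} → List (Vec (List X) k) → List X
    word cs = concat (map columnWord′ cs)

    shape : ∀ {k} → List (Vec (List X) k) → List (Vec ℕ k)
    shape = map (Vec.map length)

    fillColumn : ∀ {k} → Vec ℕ k → List X → Vec (List X) k × List X
    fillColumn []      w = [] , w
    fillColumn (a ∷ v) w = take a w ∷ proj₁ rest , proj₂ rest
      where rest = fillColumn v (drop a w)

    fill : ∀ {k} → List (Vec ℕ k) → List X → List (Vec (List X) k) × List X
    fill []      w = [] , w
    fill (v ∷ s) w = proj₁ col ∷ proj₁ rest , proj₂ rest
      where col  = fillColumn v w
            rest = fill s (proj₂ col)

    take-length-++ : ∀ (xs ys : List X) → take (length xs) (xs ++ ys) ≡ xs
    take-length-++ []       ys = refl
    take-length-++ (x ∷ xs) ys = cong (x ∷_) (take-length-++ xs ys)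

    drop-length-++ : ∀ (xs ys : List X) → drop (length xs) (xs ++ ys) ≡ ys
    drop-length-++ []       ys = refl
    drop-length-++ (x ∷ xs) ys = drop-length-++ xs ys

    fillColumn-shape : ∀ {k} (col : Vec (List X) k) r →
                       fillColumn (Vec.map length col) (columnWord′ col ++ r) ≡ (col , r)
    fillColumn-shape []        r = refl
    fillColumn-shape (x ∷ col) r
      rewrite ++-assoc x (columnWord′ col) r
            | take-length-++ x (columnWord′ col ++ r) | drop-length-++ x (columnWord′ col ++ r)
            | fillColumn-shape col r = refl

    fill-shape : ∀ {k} (cs : List (Vec (List X) k)) r → fill (shape cs) (word cs ++ r) ≡ (cs , r)
    fill-shape []         r = refl
    fill-shape (col ∷ cs) r
      rewrite ++-assoc (columnWord′ col) (word cs) r | fillColumn-shape col (word cs ++ r)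
            | fill-shape cs r = refl

    fill-shape-word : ∀ {k} (cs : List (Vec (List X) k)) → proj₁ (fill (shape cs) (word cs)) ≡ cs
    fill-shape-word cs = trans (cong (λ w → proj₁ (fill (shape cs) w)) (sym (++-identityʳ (word cs))))
                               (cong proj₁ (fill-shape cs []))

    length-columnWord : ∀ {k} (col : Vec (List X) k) → length (columnWord′ col) ≡ Vec.sum (Vec.map length col)
    length-columnWord []        = refl
    length-columnWord (x ∷ col) = trans (length-++ x) (cong (length x +_) (length-columnWord col))

    length-word : ∀ {k} (cs : List (Vec (List X) k)) → length (word cs) ≡ total (shape cs)
    length-word []         = refl
    length-word (col ∷ cs) = trans (length-++ (columnWord′ col)) (cong₂ _+_ (length-columnWord col) (length-word cs))

    shape-fillColumn : ∀ {k} (v : Vec ℕ k) (w : List X) → Vec.sum v ≤ length w →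
                       Vec.map length (proj₁ (fillColumn v w)) ≡ v ×
                       columnWord′ (proj₁ (fillColumn v w)) ++ proj₂ (fillColumn v w) ≡ w
    shape-fillColumn []      w _ = refl , refl
    shape-fillColumn (a ∷ v) w a+v≤w with shape-fillColumn v (drop a w) v≤rest
      where
      v≤rest : Vec.sum v ≤ length (drop a w)
      v≤rest = subst (Vec.sum v ≤_) (sym (length-drop a w))
                     (≤-trans (≤-reflexive (sym (m+n∸m≡n a (Vec.sum v)))) (∸-monoˡ-≤ a a+v≤w))
    ... | shape≡ , word≡ = cong₂ _∷_ length-take-a shape≡ ,
                           trans (++-assoc (take a w) _ _) (trans (cong (take a w ++_) word≡) (take++drop≡id a w))
      where
      length-take-a : length (take a w) ≡ a
      length-take-a = trans (length-take a w) (m≤n⇒m⊓n≡m (≤-trans (m≤m+n a (Vec.sum v)) a+v≤w))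

    shape-fill : ∀ {k} (s : List (Vec ℕ k)) (w : List X) → length w ≡ total s →
                 shape (proj₁ (fill s w)) ≡ s × word (proj₁ (fill s w)) ≡ w
    shape-fill []      []      _ = refl , refl
    shape-fill []      (_ ∷ _) ()
    shape-fill (v ∷ s) w w≡v+s with shape-fillColumn v w (subst (Vec.sum v ≤_) (sym w≡v+s) (m≤m+n (Vec.sum v) (total s)))
    ... | col-shape , col-word with shape-fill s (proj₂ (fillColumn v w)) rest≡s
      where
      open ≡-Reasoning
      col = proj₁ (fillColumn v w)
      rest = proj₂ (fillColumn v w)
      rest≡s : length rest ≡ total s
      rest≡s = +-cancelˡ-≡ (Vec.sum v) _ _ (begin
        Vec.sum v + length rest                          ≡⟨ cong (λ u → Vec.sum u + length rest) (sym col-shape) ⟩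
        Vec.sum (Vec.map length col) + length rest       ≡⟨ cong (_+ length rest) (sym (length-columnWord col)) ⟩
        length (columnWord′ col) + length rest           ≡⟨ sym (length-++ (columnWord′ col)) ⟩
        length (columnWord′ col ++ rest)                 ≡⟨ cong length col-word ⟩
        length w                                         ≡⟨ w≡v+s ⟩
        Vec.sum v + total s                              ∎)
    ... | rest-shape , rest-word =
      cong₂ _∷_ col-shape rest-shape , trans (cong (columnWord′ (proj₁ (fillColumn v w)) ++_) rest-word) col-word

  module WordMatrix (m n : ℕ) where
    open Fill {Fin n}
    open ShapeCount m

    Column : Set
    Column = Vec (List (Fin n)) m

    NonemptyColumn : Column → Set
    NonemptyColumn col = 1 ≤ length (columnWord col)

    StandardMatrix : Set
    StandardMatrix = Σ (List Column) (λ cs → word cs ≡ allFin n × All NonemptyColumn cs)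

    PermutedMatrix : Set
    PermutedMatrix = Σ (List Column) (λ cs → All NonemptyColumn cs × Distinct (word cs) × length (word cs) ≡ n)

    word-irrelevant : ∀ {w w′ : List (Fin n)} (p q : w ≡ w′) → p ≡ q
    word-irrelevant = Decidable⇒UIP.≡-irrelevant (List.≡-dec Finₚ._≟_)

    StandardMatrix-irrelevant : ∀ {cs} (p q : word cs ≡ allFin n × All NonemptyColumn cs) → p ≡ q
    StandardMatrix-irrelevant (e , a) (e′ , a′) = cong₂ _,_ (word-irrelevant e e′) (All.irrelevant ≤-irrelevant a a′)

    PermutedMatrix-irrelevant : ∀ {cs} (p q : All NonemptyColumn cs × Distinct (word cs) × length (word cs) ≡ n) → p ≡ q
    PermutedMatrix-irrelevant (a , d , l) (a′ , d′ , l′) =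
      cong₂ _,_ (All.irrelevant ≤-irrelevant a a′) (cong₂ _,_ (T-irrelevant d d′) (≡-irrelevant l l′))

    Perm-irrelevant : ∀ {w : List (Fin n)} (p q : Distinct w × length w ≡ n) → p ≡ q
    Perm-irrelevant (d , l) (d′ , l′) = cong₂ _,_ (T-irrelevant d d′) (≡-irrelevant l l′)

    G↔StandardMatrix : G m n ↔ StandardMatrix
    G↔StandardMatrix = mk↔ₛ′ to from to∘from from∘to
      where
      to : G m n → StandardMatrix
      to (_ , A , e , a) = toList A , e , VecAll.toList⁺ a
      from : StandardMatrix → G m n
      from (cs , e , a) = length cs , fromList cs , trans (cong word (toList∘fromList cs)) e , VecAll.fromList⁺ a
      to∘from : ∀ y → to (from y) ≡ y
      to∘from (cs , _ , _) = Σ-≡-irrelevant StandardMatrix-irrelevant (toList∘fromList cs)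
      fromList∘toList : ∀ {k} (A : Vec Column k) →
                        _≡_ {A = Σ ℕ (Vec Column)} (length (toList A) , fromList (toList A)) (k , A)
      fromList∘toList []      = refl
      fromList∘toList (x ∷ A) with length (toList A) | fromList (toList A) | fromList∘toList A
      ... | _ | _ | refl = refl
      G-≡ : ∀ {kA kA′ : Σ ℕ (Vec Column)} → kA ≡ kA′ → ∀ p p′ →
            _≡_ {A = G m n} (proj₁ kA , proj₂ kA , p) (proj₁ kA′ , proj₂ kA′ , p′)
      G-≡ refl (e , a) (e′ , a′) =
        cong₂ (λ x y → _ , _ , x , y) (word-irrelevant e e′) (VecAll.irrelevant ≤-irrelevant a a′)
      from∘to : ∀ x → from (to x) ≡ x
      from∘to (_ , A , _) = G-≡ (fromList∘toList A) _ _

    nonempty⇒nonzero : ∀ cs → All NonemptyColumn cs → All Nonzero (shape cs)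
    nonempty⇒nonzero []         []       = []
    nonempty⇒nonzero (col ∷ cs) (p ∷ ps) = subst (1 ≤_) (length-columnWord col) p ∷ nonempty⇒nonzero cs ps

    nonzero⇒nonempty : ∀ cs → All Nonzero (shape cs) → All NonemptyColumn cs
    nonzero⇒nonempty []         []       = []
    nonzero⇒nonempty (col ∷ cs) (p ∷ ps) = subst (1 ≤_) (sym (length-columnWord col)) p ∷ nonzero⇒nonempty cs ps

    filled-nonempty : ∀ (s : List (Vec ℕ m)) w → length w ≡ total s → All Nonzero s →
                      All NonemptyColumn (proj₁ (fill s w))
    filled-nonempty s w l s≢0 = nonzero⇒nonempty _ (subst (All Nonzero) (sym (proj₁ (shape-fill s w l))) s≢0)

    length-allFin : length (allFin n) ≡ n
    length-allFin = length-tabulate (λ i → i)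

    StandardMatrix↔Shape : StandardMatrix ↔ Shape n
    StandardMatrix↔Shape = mk↔ₛ′ to from to∘from from∘to
      where
      to : StandardMatrix → Shape n
      to (cs , e , a) = shape cs , trans (sym (length-word cs)) (trans (cong length e) length-allFin) ,
                        nonempty⇒nonzero cs a
      fits : ∀ (s : List (Vec ℕ m)) → total s ≡ n → length (allFin n) ≡ total s
      fits s e = trans length-allFin (sym e)
      from : Shape n → StandardMatrix
      from (s , e , s≢0) = proj₁ (fill s (allFin n)) , proj₂ (shape-fill s (allFin n) (fits s e)) ,
                           filled-nonempty s (allFin n) (fits s e) s≢0
      to∘from : ∀ y → to (from y) ≡ y
      to∘from (s , e , _) =
        Σ-≡-irrelevant (λ { (e , a) (e′ , a′) → cong₂ _,_ (≡-irrelevant e e′) (All.irrelevant ≤-irrelevant a a′) })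
                       (proj₁ (shape-fill s (allFin n) (fits s e)))
      from∘to : ∀ x → from (to x) ≡ x
      from∘to (cs , e , _) =
        Σ-≡-irrelevant StandardMatrix-irrelevant
          (trans (cong (λ w → proj₁ (fill (shape cs) w)) (sym e)) (fill-shape-word cs))

    G↔Fin : G m n ↔ Fin (∑ (suc n) (λ j → MatrixCount.matrices m j n))
    G↔Fin = G↔StandardMatrix ⟨↔⟩ StandardMatrix↔Shape ⟨↔⟩ Shape↔Fin n

    Perm×StandardMatrix↔PermutedMatrix : (Perm n × StandardMatrix) ↔ PermutedMatrix
    Perm×StandardMatrix↔PermutedMatrix = mk↔ₛ′ to from to∘from from∘to
      where
      fits : ∀ (w : List (Fin n)) cs → length w ≡ n → word cs ≡ allFin n → length w ≡ total (shape cs)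
      fits w cs l e = trans l (trans (sym length-allFin) (trans (cong length (sym e)) (length-word cs)))
      to : Perm n × StandardMatrix → PermutedMatrix
      to ((w , d , l) , (cs , e , a)) =
        proj₁ (fill (shape cs) w) ,
        filled-nonempty (shape cs) w (fits w cs l e) (nonempty⇒nonzero cs a) ,
        subst Distinct (sym (proj₂ (shape-fill (shape cs) w (fits w cs l e)))) d ,
        trans (cong length (proj₂ (shape-fill (shape cs) w (fits w cs l e)))) l
      standard-fits : ∀ cs → length (word cs) ≡ n → length (allFin n) ≡ total (shape cs)
      standard-fits cs l = trans length-allFin (trans (sym l) (length-word cs))
      from : PermutedMatrix → Perm n × StandardMatrix
      from (cs , a , d , l) =
        (word cs , d , l) ,
        (proj₁ (fill (shape cs) (allFin n)) , proj₂ (shape-fill (shape cs) (allFin n) (standard-fits cs l)) ,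
         filled-nonempty (shape cs) (allFin n) (standard-fits cs l) (nonempty⇒nonzero cs a))
      to∘from : ∀ y → to (from y) ≡ y
      to∘from (cs , _ , _ , l) =
        Σ-≡-irrelevant PermutedMatrix-irrelevant
          (trans (cong (λ s → proj₁ (fill s (word cs))) (proj₁ (shape-fill (shape cs) (allFin n) (standard-fits cs l))))
                 (fill-shape-word cs))
      from∘to : ∀ x → from (to x) ≡ x
      from∘to ((w , _ , l) , (cs , e , _)) =
        cong₂ _,_ (Σ-≡-irrelevant Perm-irrelevant (proj₂ filled))
                  (Σ-≡-irrelevant StandardMatrix-irrelevant
                    (trans (cong (λ s → proj₁ (fill s (allFin n))) (proj₁ filled))
                           (trans (cong (λ w → proj₁ (fill (shape cs) w)) (sym e)) (fill-shape-word cs))))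
        where filled = shape-fill (shape cs) w (fits w cs l e)

module Factorization where

  open import Data.Nat using (ℕ)
  open import Data.Fin using (Fin; _<_)
  open import Data.Fin.Properties using (_<?_; <-trans; <-irrefl; <-asym; <-cmp)
  open import Data.List using (List; []; _∷_; _++_; concat; map; reverse; foldr)
  open import Data.List.Properties using (++-assoc; ++-identityʳ; map-++; concat-++; unfold-reverse)
  open import Data.List.Relation.Unary.All as All using (All; []; _∷_)
  import Data.List.Relation.Unary.All.Properties as All
  open import Data.List.Relation.Unary.AllPairs using (AllPairs; []; _∷_)
  import Data.List.Relation.Unary.AllPairs.Properties as AllPairs
  open import Data.List.Relation.Unary.Linked using (Linked; []; [-]; _∷_)
  open import Data.List.Relation.Unary.Unique.Propositional using (Unique)
  open import Data.List.Membership.Propositional using (_∈_; _∉_)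
  open import Data.List.Membership.Propositional.Properties using (∈-++⁺ʳ)
  open import Data.List.Relation.Unary.Any using (here; there)
  import Data.List.Relation.Binary.Permutation.Propositional as ↭
  open ↭ using (_↭_; ↭-refl; ↭-sym; ↭-trans; prep; swap; ↭⇒↭ₛ)
  open import Data.List.Relation.Binary.Permutation.Propositional.Properties
    using (All-resp-↭; ↭-reverse; shifts; ++⁺ˡ)
  import Data.List.Relation.Binary.Permutation.Setoid.Properties as PermutationSetoid
  open import Data.Product using (_×_; _,_; proj₁)
  open import Data.Unit using (⊤; tt)
  open import Data.Empty using (⊥-elim)
  open import Function using (flip)
  open import Relation.Nullary using (¬_; yes; no)
  open import Relation.Binary using (Symmetric; tri<; tri≈; tri>)
  open import Relation.Binary.PropositionalEquality

  module _ {A B : Set} where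

    concatMap-++ : ∀ (f : A → List B) xs ys → concat (map f (xs ++ ys)) ≡ concat (map f xs) ++ concat (map f ys)
    concatMap-++ f xs ys = trans (cong concat (map-++ f xs ys)) (sym (concat-++ (map f xs) (map f ys)))

    concatMap-↭ : ∀ (f : A → List B) {xs ys} → xs ↭ ys → concat (map f xs) ↭ concat (map f ys)
    concatMap-↭ f ↭.refl         = ↭-refl
    concatMap-↭ f (prep x p)     = ++⁺ˡ (f x) (concatMap-↭ f p)
    concatMap-↭ f (swap x y p)   = ↭-trans (++⁺ˡ (f x) (++⁺ˡ (f y) (concatMap-↭ f p))) (shifts (f x) (f y))
    concatMap-↭ f (↭.trans p q)  = ↭-trans (concatMap-↭ f p) (concatMap-↭ f q)

  module _ {A : Set} where

    AllPairs-resp-↭ : ∀ {R : A → A → Set} → Symmetric R → ∀ {xs ys} → xs ↭ ys → AllPairs R xs → AllPairs R ys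
    AllPairs-resp-↭ sym p =
      PermutationSetoid.AllPairs-resp-↭ (setoid A) sym ((λ { refl r → r }) , (λ { refl r → r })) (↭⇒↭ₛ p)

    Unique-resp-↭ : ∀ {xs ys : List A} → xs ↭ ys → Unique xs → Unique ys
    Unique-resp-↭ p = PermutationSetoid.Unique-resp-↭ (setoid A) (↭⇒↭ₛ p)

    AllPairs-reverse : ∀ {R : A → A → Set} {xs} → AllPairs R xs → AllPairs (flip R) (reverse xs)
    AllPairs-reverse {xs = []}     []       = []
    AllPairs-reverse {xs = x ∷ xs} (p ∷ ps) rewrite unfold-reverse x xs =
      AllPairs.++⁺ (AllPairs-reverse ps) ([] ∷ []) (All.map (_∷ []) (All-resp-↭ (↭-sym (↭-reverse xs)) p))

    AllPairs-++⁻ʳ : ∀ {R : A → A → Set} xs {ys} → AllPairs R (xs ++ ys) → AllPairs R ys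
    AllPairs-++⁻ʳ []       ps       = ps
    AllPairs-++⁻ʳ (x ∷ xs) (_ ∷ ps) = AllPairs-++⁻ʳ xs ps

    AllPairs-++⁻ˡ : ∀ {R : A → A → Set} xs {ys} → AllPairs R (xs ++ ys) → AllPairs R xs
    AllPairs-++⁻ˡ []       _        = []
    AllPairs-++⁻ˡ (x ∷ xs) (p ∷ ps) = All.++⁻ˡ xs p ∷ AllPairs-++⁻ˡ xs ps

  module SortBy {n : ℕ} {T : Set} (key : T → Fin n) where

    _≺_ : T → T → Set
    a ≺ b = key a < key b

    insert : T → List T → List T
    insert a []      = a ∷ []
    insert a (b ∷ L) with key b <? key a
    ... | yes _ = b ∷ insert a L
    ... | no  _ = a ∷ b ∷ L

    sort : List T → List T
    sort = foldr insert []

    insert-↭ : ∀ a L → insert a L ↭ a ∷ L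
    insert-↭ a []      = ↭-refl
    insert-↭ a (b ∷ L) with key b <? key a
    ... | yes _ = ↭-trans (prep b (insert-↭ a L)) (swap b a ↭-refl)
    ... | no  _ = ↭-refl

    sort-↭ : ∀ L → sort L ↭ L
    sort-↭ []      = ↭-refl
    sort-↭ (a ∷ L) = ↭-trans (insert-↭ a (sort L)) (prep a (sort-↭ L))

    DistinctKeys : T → T → Set
    DistinctKeys a b = key a ≢ key b

    insert-sorted : ∀ a L → AllPairs _≺_ L → All (DistinctKeys a) L → AllPairs _≺_ (insert a L)
    insert-sorted a []      _        _        = [] ∷ []
    insert-sorted a (b ∷ L) (b≺L ∷ L↑) (a≠b ∷ a≠L) with key b <? key a
    ... | yes b≺a = All-resp-↭ (↭-sym (insert-↭ a L)) (b≺a ∷ b≺L) ∷ insert-sorted a L L↑ a≠L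
    ... | no  b⊀a with <-cmp (key a) (key b)
    ...   | tri< a≺b _ _ = (a≺b ∷ All.map (<-trans a≺b) b≺L) ∷ b≺L ∷ L↑
    ...   | tri≈ _ a=b _ = ⊥-elim (a≠b a=b)
    ...   | tri> _ _ b≺a = ⊥-elim (b⊀a b≺a)

    sort-sorted : ∀ L → AllPairs DistinctKeys L → AllPairs _≺_ (sort L)
    sort-sorted []      _            = []
    sort-sorted (a ∷ L) (a≠L ∷ L≠) =
      insert-sorted a (sort L) (sort-sorted L L≠) (All-resp-↭ (↭-sym (sort-↭ L)) a≠L)

    sorted-unique : ∀ L₁ L₂ → AllPairs _≺_ L₁ → AllPairs _≺_ L₂ →
                    (∀ z → z ∈ L₁ → z ∈ L₂) → (∀ z → z ∈ L₂ → z ∈ L₁) → L₁ ≡ L₂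
    sorted-unique []       []       _ _ _ _ = refl
    sorted-unique []       (b ∷ L₂) _ _ _ ⊇ with () ← ⊇ b (here refl)
    sorted-unique (a ∷ L₁) []       _ _ ⊆ _ with () ← ⊆ a (here refl)
    sorted-unique (a ∷ L₁) (b ∷ L₂) (a≺ ∷ L₁↑) (b≺ ∷ L₂↑) ⊆ ⊇ with ⊆ a (here refl) | ⊇ b (here refl)
    ... | there a∈ | there b∈  = ⊥-elim (<-asym (All.lookup a≺ b∈) (All.lookup b≺ a∈))
    ... | there a∈ | here refl = ⊥-elim (<-irrefl refl (All.lookup b≺ a∈))
    ... | here refl | _        = cong (a ∷_) (sorted-unique L₁ L₂ L₁↑ L₂↑ (tail-⊆ a≺ ⊆) (tail-⊆ b≺ ⊇))
      where
      tail-⊆ : ∀ {x xs ys} → All (x ≺_) xs → (∀ z → z ∈ x ∷ xs → z ∈ x ∷ ys) → ∀ z → z ∈ xs → z ∈ ys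
      tail-⊆ x≺ ⊆′ z z∈ with ⊆′ z (there z∈)
      ... | here refl = ⊥-elim (<-irrefl refl (All.lookup x≺ z∈))
      ... | there z∈′ = z∈′

  -- Factorization of a word with distinct letters at its left-to-right minima

  module Factorize (n : ℕ) where

    Block : Set
    Block = Fin n × List (Fin n)

    lead : Block → Fin n
    lead = proj₁

    blockWord : Block → List (Fin n)
    blockWord (x , ys) = x ∷ ys

    blocksWord : List Block → List (Fin n)
    blocksWord bs = concat (map blockWord bs)

    Connected : Block → Set
    Connected (x , ys) = All (x <_) ys

    _≻_ : Block → Block → Set
    b ≻ c = lead c < lead b

    ≻-trans : ∀ {a b c} → a ≻ b → b ≻ c → a ≻ c
    ≻-trans a≻b b≻c = <-trans b≻c a≻b

    absorb : Block → List Block → List Block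
    absorb b              []              = b ∷ []
    absorb (x , ys) ((z , zs) ∷ bs) with x <? z
    ... | yes _ = absorb (x , ys ++ z ∷ zs) bs
    ... | no  _ = (x , ys) ∷ (z , zs) ∷ bs

    factorize : List (Fin n) → List Block
    factorize []      = []
    factorize (x ∷ w) = absorb (x , []) (factorize w)

    blocksWord-absorb : ∀ x ys bs → blocksWord (absorb (x , ys) bs) ≡ x ∷ ys ++ blocksWord bs
    blocksWord-absorb x ys []              = refl
    blocksWord-absorb x ys ((z , zs) ∷ bs) with x <? z
    ... | yes _ = trans (blocksWord-absorb x (ys ++ z ∷ zs) bs) (cong (x ∷_) (++-assoc ys (z ∷ zs) (blocksWord bs)))
    ... | no  _ = refl

    blocksWord-factorize : ∀ w → blocksWord (factorize w) ≡ w
    blocksWord-factorize []      = refl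
    blocksWord-factorize (x ∷ w) = trans (blocksWord-absorb x [] (factorize w)) (cong (x ∷_) (blocksWord-factorize w))

    absorb-connected : ∀ b bs → Connected b → All Connected bs → All Connected (absorb b bs)
    absorb-connected b        []              b-conn []               = b-conn ∷ []
    absorb-connected (x , ys) ((z , zs) ∷ bs) b-conn (c-conn ∷ bs-conn) with x <? z
    ... | yes x<z = absorb-connected (x , ys ++ z ∷ zs) bs
                      (All.++⁺ b-conn (x<z ∷ All.map (<-trans x<z) c-conn)) bs-conn
    ... | no  _   = b-conn ∷ c-conn ∷ bs-conn

    factorize-connected : ∀ w → All Connected (factorize w)
    factorize-connected []      = []
    factorize-connected (x ∷ w) = absorb-connected (x , []) (factorize w) [] (factorize-connected w)

    absorb-descending : ∀ x ys bs → Linked _≻_ bs → x ∉ blocksWord bs → Linked _≻_ (absorb (x , ys) bs)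
    absorb-descending x ys []              _  _   = [-]
    absorb-descending x ys ((z , zs) ∷ bs) bs↓ x∉ with x <? z
    ... | yes _ = absorb-descending x (ys ++ z ∷ zs) bs (Linked-tail bs↓) (λ x∈ → x∉ (∈-++⁺ʳ (z ∷ zs) x∈))
      where
      Linked-tail : ∀ {a l} → Linked _≻_ (a ∷ l) → Linked _≻_ l
      Linked-tail [-]     = []
      Linked-tail (_ ∷ l) = l
    ... | no x≮z with <-cmp x z
    ...   | tri< x<z _ _ = ⊥-elim (x≮z x<z)
    ...   | tri≈ _ refl _ = ⊥-elim (x∉ (here refl))
    ...   | tri> _ _ z<x = z<x ∷ bs↓

    factorize-descending : ∀ w → Unique w → Linked _≻_ (factorize w)
    factorize-descending []      _          = []
    factorize-descending (x ∷ w) (x∉w ∷ w!) =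
      absorb-descending x [] (factorize w) (factorize-descending w w!)
        (λ x∈ → All.lookup x∉w (subst (x ∈_) (blocksWord-factorize w) x∈) refl)

    Stops : Fin n → List Block → Set
    Stops y []      = ⊤
    Stops y (c ∷ _) = ¬ (y < lead c)

    absorb-++ : ∀ b L bs → Stops (lead b) bs → absorb b (L ++ bs) ≡ absorb b L ++ bs
    absorb-++ b        []              []              _ = refl
    absorb-++ (x , ys) []              ((z , zs) ∷ bs) x≮z with x <? z
    ... | yes x<z = ⊥-elim (x≮z x<z)
    ... | no  _   = refl
    absorb-++ (x , ys) ((z , zs) ∷ L) bs x-stops with x <? z
    ... | yes _ = absorb-++ (x , ys ++ z ∷ zs) L bs x-stops
    ... | no  _ = refl

    factorize-++ : ∀ ys R → All (λ y → Stops y (factorize R)) ys → factorize (ys ++ R) ≡ factorize ys ++ factorize R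
    factorize-++ []       R _          = refl
    factorize-++ (y ∷ ys) R (y-stops ∷ ys-stop) =
      trans (cong (absorb (y , [])) (factorize-++ ys R ys-stop)) (absorb-++ (y , []) (factorize ys) (factorize R) y-stops)

    absorb-all : ∀ x acc bs → All (λ b → x < lead b) bs → absorb (x , acc) bs ≡ (x , acc ++ blocksWord bs) ∷ []
    absorb-all x acc []              []         = cong (λ l → (x , l) ∷ []) (sym (++-identityʳ acc))
    absorb-all x acc ((z , zs) ∷ bs) (x<z ∷ x<bs) with x <? z
    ... | yes _   = trans (absorb-all x (acc ++ z ∷ zs) bs x<bs)
                          (cong (λ l → (x , l) ∷ []) (++-assoc acc (z ∷ zs) (blocksWord bs)))
    ... | no  x≮z = ⊥-elim (x≮z x<z)

    All-leads : ∀ {P : Fin n → Set} bs → All P (blocksWord bs) → All (λ b → P (lead b)) bs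
    All-leads []              _          = []
    All-leads ((z , zs) ∷ bs) (pz ∷ pzs) = pz ∷ All-leads bs (All.++⁻ʳ zs pzs)

    factorize-block-++ : ∀ x ys bs → All (x <_) ys → factorize (blocksWord bs) ≡ bs →
                         Stops x bs → All (λ y → Stops y bs) ys →
                         factorize (blocksWord ((x , ys) ∷ bs)) ≡ (x , ys) ∷ bs
    factorize-block-++ x ys bs x<ys bs-fixed x-stops ys-stop = begin
      absorb (x , []) (factorize (ys ++ blocksWord bs))
        ≡⟨ cong (absorb (x , [])) (factorize-++ ys (blocksWord bs)
                                    (subst (λ l → All (λ y → Stops y l) ys) (sym bs-fixed) ys-stop)) ⟩
      absorb (x , []) (factorize ys ++ factorize (blocksWord bs))
        ≡⟨ cong (λ l → absorb (x , []) (factorize ys ++ l)) bs-fixed ⟩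
      absorb (x , []) (factorize ys ++ bs)
        ≡⟨ absorb-++ (x , []) (factorize ys) bs x-stops ⟩
      absorb (x , []) (factorize ys) ++ bs
        ≡⟨ cong (_++ bs) (absorb-all x [] (factorize ys)
                            (All-leads (factorize ys) (subst (All (x <_)) (sym (blocksWord-factorize ys)) x<ys))) ⟩
      (x , blocksWord (factorize ys)) ∷ bs
        ≡⟨ cong (λ l → (x , l) ∷ bs) (blocksWord-factorize ys) ⟩
      (x , ys) ∷ bs ∎
      where open ≡-Reasoning

    factorize-blocksWord : ∀ bs → All Connected bs → Linked _≻_ bs → factorize (blocksWord bs) ≡ bs
    factorize-blocksWord []                 _ _ = refl
    factorize-blocksWord ((x , ys) ∷ [])    (x<ys ∷ _) _ =
      factorize-block-++ x ys [] x<ys refl tt (All.map (λ _ → tt) x<ys)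
    factorize-blocksWord ((x , ys) ∷ (z , zs) ∷ bs) (x<ys ∷ bs-conn) (z<x ∷ bs↓) =
      factorize-block-++ x ys ((z , zs) ∷ bs) x<ys (factorize-blocksWord ((z , zs) ∷ bs) bs-conn bs↓)
        (λ x<z → <-irrefl refl (<-trans x<z z<x))
        (All.map (λ x<y y<z → <-irrefl refl (<-trans (<-trans z<x x<y) y<z)) x<ys)

module Levels where

  open import Defs using (columnWord)
  open import Data.Nat using (ℕ; zero; suc; _≤_; z≤n; s≤s)
  open import Data.Fin using (Fin; zero; suc)
  open import Data.Fin.Properties using (_≟_; <⇒≢; suc-injective)
  open import Data.List using (List; []; _∷_; _++_; concat; map; reverse; length)
  open import Data.List.Properties using (reverse-involutive)
  open import Data.List.Relation.Unary.All as All using (All; []; _∷_)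
  import Data.List.Relation.Unary.All.Properties as All
  open import Data.List.Relation.Unary.AllPairs as AllPairs using (AllPairs; []; _∷_)
  open import Data.List.Relation.Unary.Linked.Properties using (Linked⇒AllPairs; AllPairs⇒Linked)
  open import Data.List.Relation.Unary.Unique.Propositional using (Unique)
  open import Data.List.Membership.Propositional using (_∈_)
  open import Data.List.Membership.Propositional.Properties using (∈-++⁺ˡ; ∈-++⁺ʳ; ∈-++⁻; ∈-map⁺; ∈-map⁻)
  open import Data.List.Relation.Unary.Any using (here; there)
  import Data.List.Relation.Binary.Permutation.Propositional as ↭
  open ↭ using (_↭_; ↭-refl; ↭-sym; ↭-trans; prep; ↭-reflexive)
  open import Data.List.Relation.Binary.Permutation.Propositional.Properties
    using (All-resp-↭; ∈-resp-↭; ↭-reverse; shift; ++⁺ˡ; ++⁺; map⁺; ↭-length)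
  open import Data.Vec using (Vec; []; _∷_; lookup; tabulate)
  open import Data.Vec.Properties using (tabulate∘lookup; tabulate-cong)
  open import Data.Product using (Σ; _×_; _,_; proj₁)
  open import Data.Sum using (inj₁; inj₂)
  open import Data.Empty using (⊥-elim)
  open import Function using (_∘_; id)
  open import Relation.Nullary using (yes; no)
  open import Relation.Binary.PropositionalEquality
  open Factorization

  module ColumnLevel (n m : ℕ) where
    open Factorize n
    module BlockOrder = SortBy lead

    ColouredBlock : Set
    ColouredBlock = Block × Fin m

    colouredLead : ColouredBlock → Fin n
    colouredLead = lead ∘ proj₁

    open SortBy colouredLead
    open Matrices.WordMatrix m n using (Column)

    colouredWord : List ColouredBlock → List (Fin n)
    colouredWord L = concat (map (blockWord ∘ proj₁) L)

    paint : Fin m → Block → ColouredBlock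
    paint c b = b , c

    rowBlocks : ∀ {k} → (Fin k → Fin m) → Vec (List (Fin n)) k → List ColouredBlock
    rowBlocks colour []       = []
    rowBlocks colour (w ∷ ws) = map (paint (colour zero)) (factorize w) ++ rowBlocks (colour ∘ suc) ws

    ofColour : Fin m → List ColouredBlock → List Block
    ofColour r []             = []
    ofColour r ((b , c) ∷ L) with c ≟ r
    ... | yes _ = b ∷ ofColour r L
    ... | no  _ = ofColour r L

    IsLevel : List ColouredBlock → Set
    IsLevel L = 1 ≤ length L × All (Connected ∘ proj₁) L × AllPairs _≺_ L

    toLevel : Column → List ColouredBlock
    toLevel col = sort (rowBlocks id col)

    toColumn : List ColouredBlock → Column
    toColumn L = tabulate (λ r → blocksWord (reverse (ofColour r L)))

    colouredWord-paint : ∀ c D → colouredWord (map (paint c) D) ≡ blocksWord D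
    colouredWord-paint c []      = refl
    colouredWord-paint c (b ∷ D) = cong (blockWord b ++_) (colouredWord-paint c D)

    colouredWord-++ : ∀ A B → colouredWord (A ++ B) ≡ colouredWord A ++ colouredWord B
    colouredWord-++ = concatMap-++ (blockWord ∘ proj₁)

    colouredWord-↭ : ∀ {A B} → A ↭ B → colouredWord A ↭ colouredWord B
    colouredWord-↭ = concatMap-↭ (blockWord ∘ proj₁)

    colouredWord-rowBlocks : ∀ {k} (colour : Fin k → Fin m) ws → colouredWord (rowBlocks colour ws) ≡ columnWord ws
    colouredWord-rowBlocks colour []       = refl
    colouredWord-rowBlocks colour (w ∷ ws) =
      trans (colouredWord-++ (map (paint (colour zero)) (factorize w)) (rowBlocks (colour ∘ suc) ws))
            (cong₂ _++_ (trans (colouredWord-paint (colour zero) (factorize w)) (blocksWord-factorize w))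
                        (colouredWord-rowBlocks (colour ∘ suc) ws))

    ∈-rowBlocks⁺ : ∀ {k} (colour : Fin k → Fin m) ws i b → b ∈ factorize (lookup ws i) →
                   (b , colour i) ∈ rowBlocks colour ws
    ∈-rowBlocks⁺ colour (w ∷ ws) zero    b b∈ = ∈-++⁺ˡ (∈-map⁺ (paint (colour zero)) b∈)
    ∈-rowBlocks⁺ colour (w ∷ ws) (suc i) b b∈ =
      ∈-++⁺ʳ (map (paint (colour zero)) (factorize w)) (∈-rowBlocks⁺ (colour ∘ suc) ws i b b∈)

    ∈-rowBlocks⁻ : ∀ {k} (colour : Fin k → Fin m) ws b r → (b , r) ∈ rowBlocks colour ws →
                   Σ (Fin k) (λ i → colour i ≡ r × b ∈ factorize (lookup ws i))
    ∈-rowBlocks⁻ colour (w ∷ ws) b r b∈ with ∈-++⁻ (map (paint (colour zero)) (factorize w)) b∈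
    ... | inj₁ b∈w with ∈-map⁻ (paint (colour zero)) b∈w
    ...   | _ , b∈′ , refl = zero , refl , b∈′
    ∈-rowBlocks⁻ colour (w ∷ ws) b r b∈ | inj₂ b∈ws with ∈-rowBlocks⁻ (colour ∘ suc) ws b r b∈ws
    ... | i , e , b∈′ = suc i , e , b∈′

    ∈-ofColour⁻ : ∀ r L b → b ∈ ofColour r L → (b , r) ∈ L
    ∈-ofColour⁻ r ((b′ , c) ∷ L) b b∈ with c ≟ r
    ∈-ofColour⁻ r ((b′ , c) ∷ L) b (here refl) | yes refl = here refl
    ∈-ofColour⁻ r ((b′ , c) ∷ L) b (there b∈)  | yes _    = there (∈-ofColour⁻ r L b b∈)
    ... | no _ = there (∈-ofColour⁻ r L b b∈)

    ∈-ofColour⁺ : ∀ r L b → (b , r) ∈ L → b ∈ ofColour r L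
    ∈-ofColour⁺ r ((b′ , c) ∷ L) b b∈ with c ≟ r
    ∈-ofColour⁺ r ((b′ , c) ∷ L) b (here refl) | yes _  = here refl
    ∈-ofColour⁺ r ((b′ , c) ∷ L) b (there b∈)  | yes _  = there (∈-ofColour⁺ r L b b∈)
    ∈-ofColour⁺ r ((b′ , c) ∷ L) b (here refl) | no c≢r = ⊥-elim (c≢r refl)
    ∈-ofColour⁺ r ((b′ , c) ∷ L) b (there b∈)  | no _   = ∈-ofColour⁺ r L b b∈

    ofColour-All : ∀ {P : Block → Set} r L → All (P ∘ proj₁) L → All P (ofColour r L)
    ofColour-All r []             []         = []
    ofColour-All r ((b , c) ∷ L) (pb ∷ pL) with c ≟ r
    ... | yes _ = pb ∷ ofColour-All r L pL
    ... | no  _ = ofColour-All r L pL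

    ofColour-sorted : ∀ r L → AllPairs _≺_ L → AllPairs BlockOrder._≺_ (ofColour r L)
    ofColour-sorted r []             []         = []
    ofColour-sorted r ((b , c) ∷ L) (b≺ ∷ L↑) with c ≟ r
    ... | yes _ = ofColour-All r L b≺ ∷ ofColour-sorted r L L↑
    ... | no  _ = ofColour-sorted r L L↑

    rowBlocks-connected : ∀ {k} (colour : Fin k → Fin m) ws → All (Connected ∘ proj₁) (rowBlocks colour ws)
    rowBlocks-connected colour []       = []
    rowBlocks-connected colour (w ∷ ws) = All.++⁺ (All.map⁺ (factorize-connected w)) (rowBlocks-connected (colour ∘ suc) ws)

    lead∈colouredWord : ∀ L x → x ∈ L → colouredLead x ∈ colouredWord L
    lead∈colouredWord (((z , zs) , c) ∷ L) _ (here refl) = here refl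
    lead∈colouredWord (b ∷ L)              x (there x∈)  = ∈-++⁺ʳ (blockWord (proj₁ b)) (lead∈colouredWord L x x∈)

    distinct-leads : ∀ L → Unique (colouredWord L) → AllPairs DistinctKeys L
    distinct-leads []                   _          = []
    distinct-leads (((z , zs) , c) ∷ L) (z∉ ∷ L!) =
      All.tabulate (λ {x} x∈ e → All.lookup z∉ (∈-++⁺ʳ zs (lead∈colouredWord L x x∈)) e)
      ∷ distinct-leads L (AllPairs-++⁻ʳ zs L!)

    byColour : ∀ {k} → (Fin k → Fin m) → List ColouredBlock → List ColouredBlock
    byColour {zero} colour L = []
    byColour {suc k} colour L = map (paint (colour zero)) (ofColour (colour zero) L) ++ byColour (colour ∘ suc) L

    byColourReversed : ∀ {k} → (Fin k → Fin m) → List ColouredBlock → List ColouredBlock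
    byColourReversed {zero} colour L = []
    byColourReversed {suc k} colour L =
      map (paint (colour zero)) (reverse (ofColour (colour zero) L)) ++ byColourReversed (colour ∘ suc) L

    byColour-[] : ∀ {k} (colour : Fin k → Fin m) → byColour colour [] ≡ []
    byColour-[] {zero}  colour = refl
    byColour-[] {suc k} colour = byColour-[] (colour ∘ suc)

    byColour-missing : ∀ {k} (colour : Fin k → Fin m) b c L → (∀ i → colour i ≢ c) →
                       byColour colour ((b , c) ∷ L) ≡ byColour colour L
    byColour-missing {zero}  colour b c L _ = refl
    byColour-missing {suc k} colour b c L c∉ with c ≟ colour zero
    ... | yes c≡ = ⊥-elim (c∉ zero (sym c≡))
    ... | no  _  = cong (map (paint (colour zero)) (ofColour (colour zero) L) ++_)
                        (byColour-missing (colour ∘ suc) b c L (c∉ ∘ suc))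

    byColour-∷ : ∀ {k} (colour : Fin k → Fin m) → (∀ {i j} → colour i ≡ colour j → i ≡ j) →
                 ∀ b c L i → colour i ≡ c → byColour colour ((b , c) ∷ L) ↭ (b , c) ∷ byColour colour L
    byColour-∷ colour injective b c L zero refl with c ≟ colour zero
    ... | yes refl = prep (b , c) (↭-reflexive (cong (map (paint c) (ofColour c L) ++_)
                       (byColour-missing (colour ∘ suc) b c L (λ i e → 0≢suc (injective (sym e))))))
      where
      0≢suc : ∀ {k} {i : Fin k} → zero ≢ suc i
      0≢suc ()
    ... | no c≢ = ⊥-elim (c≢ refl)
    byColour-∷ colour injective b c L (suc i) e with c ≟ colour zero
    ... | yes c≡ = ⊥-elim (suc≢0 (injective (trans e c≡)))
      where
      suc≢0 : ∀ {k} {i : Fin k} → suc i ≢ zero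
      suc≢0 ()
    ... | no _ = ↭-trans (++⁺ˡ (map (paint (colour zero)) (ofColour (colour zero) L))
                               (byColour-∷ (colour ∘ suc) (suc-injective ∘ injective) b c L i e))
                        (shift (b , c) (map (paint (colour zero)) (ofColour (colour zero) L)) (byColour (colour ∘ suc) L))

    ↭-byColour : ∀ L → L ↭ byColour id L
    ↭-byColour []            = ↭-reflexive (sym (byColour-[] id))
    ↭-byColour ((b , c) ∷ L) = ↭-trans (prep (b , c) (↭-byColour L)) (↭-sym (byColour-∷ id id b c L c refl))

    byColourReversed-↭ : ∀ {k} (colour : Fin k → Fin m) L → byColourReversed colour L ↭ byColour colour L
    byColourReversed-↭ {zero}  colour L = ↭-refl
    byColourReversed-↭ {suc k} colour L =
      ++⁺ (map⁺ (paint (colour zero)) (↭-reverse (ofColour (colour zero) L))) (byColourReversed-↭ (colour ∘ suc) L)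

    byColourReversed-↭-id : ∀ L → byColourReversed id L ↭ L
    byColourReversed-↭-id L = ↭-trans (byColourReversed-↭ id L) (↭-sym (↭-byColour L))

    rowBlocks-toColumn : ∀ {k} (colour : Fin k → Fin m) L →
                         (∀ r → factorize (blocksWord (reverse (ofColour r L))) ≡ reverse (ofColour r L)) →
                         rowBlocks colour (tabulate (λ i → blocksWord (reverse (ofColour (colour i) L)))) ≡ byColourReversed colour L
    rowBlocks-toColumn {zero}  colour L _     = refl
    rowBlocks-toColumn {suc k} colour L fixed =
      cong₂ _++_ (cong (map (paint (colour zero))) (fixed (colour zero))) (rowBlocks-toColumn (colour ∘ suc) L fixed)

    columnWord-toColumn : ∀ {k} (colour : Fin k → Fin m) L →
                          columnWord (tabulate (λ i → blocksWord (reverse (ofColour (colour i) L)))) ≡ colouredWord (byColourReversed colour L)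
    columnWord-toColumn {zero}  colour L = refl
    columnWord-toColumn {suc k} colour L = sym (trans
      (colouredWord-++ (map (paint (colour zero)) (reverse (ofColour (colour zero) L))) (byColourReversed (colour ∘ suc) L))
      (cong₂ _++_ (colouredWord-paint (colour zero) (reverse (ofColour (colour zero) L)))
                  (sym (columnWord-toColumn (colour ∘ suc) L))))

    Unique-lookup : ∀ {k} (col : Vec (List (Fin n)) k) i → Unique (columnWord col) → Unique (lookup col i)
    Unique-lookup (w ∷ ws) zero    w! = AllPairs-++⁻ˡ w w!
    Unique-lookup (w ∷ ws) (suc i) w! = Unique-lookup ws i (AllPairs-++⁻ʳ w w!)

    -- Both sides list the blocks of row r in increasing order of their leads.
    ofColour-toLevel : ∀ col → Unique (columnWord col) → ∀ r → ofColour r (toLevel col) ≡ reverse (factorize (lookup col r))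
    ofColour-toLevel col col! r =
      BlockOrder.sorted-unique _ _ (ofColour-sorted r (toLevel col) sorted)
        (AllPairs-reverse (Linked⇒AllPairs (λ {a} {b} {c} → ≻-trans {a} {b} {c})
                                           (factorize-descending (lookup col r) (Unique-lookup col r col!))))
        ⊆ ⊇
      where
      B = rowBlocks id col
      sorted : AllPairs _≺_ (toLevel col)
      sorted = sort-sorted B (distinct-leads B (subst Unique (sym (colouredWord-rowBlocks id col)) col!))
      ⊆ : ∀ z → z ∈ ofColour r (toLevel col) → z ∈ reverse (factorize (lookup col r))
      ⊆ z z∈ with ∈-rowBlocks⁻ id col z r (∈-resp-↭ (sort-↭ B) (∈-ofColour⁻ r (toLevel col) z z∈))
      ... | i , refl , z∈′ = ∈-resp-↭ (↭-sym (↭-reverse _)) z∈′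
      ⊇ : ∀ z → z ∈ reverse (factorize (lookup col r)) → z ∈ ofColour r (toLevel col)
      ⊇ z z∈ = ∈-ofColour⁺ r (toLevel col) z (∈-resp-↭ (↭-sym (sort-↭ B))
                 (∈-rowBlocks⁺ id col r z (∈-resp-↭ (↭-reverse _) z∈)))

    toColumn-toLevel : ∀ col → Unique (columnWord col) → toColumn (toLevel col) ≡ col
    toColumn-toLevel col col! = trans (tabulate-cong row) (tabulate∘lookup col)
      where
      row : ∀ r → blocksWord (reverse (ofColour r (toLevel col))) ≡ lookup col r
      row r = trans (cong (blocksWord ∘ reverse) (ofColour-toLevel col col! r))
                    (trans (cong blocksWord (reverse-involutive (factorize (lookup col r))))
                           (blocksWord-factorize (lookup col r)))

    toLevel-toColumn : ∀ L → AllPairs _≺_ L → All (Connected ∘ proj₁) L → toLevel (toColumn L) ≡ L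
    toLevel-toColumn L L↑ L-conn =
      trans (cong sort (rowBlocks-toColumn id L fixed)) (sorted-unique _ _ sorted L↑ ⊆ ⊇)
      where
      fixed : ∀ r → factorize (blocksWord (reverse (ofColour r L))) ≡ reverse (ofColour r L)
      fixed r = factorize-blocksWord (reverse (ofColour r L))
                  (All-resp-↭ (↭-sym (↭-reverse _)) (ofColour-All r L L-conn))
                  (AllPairs⇒Linked (AllPairs-reverse (ofColour-sorted r L L↑)))
      perm = byColourReversed-↭-id L
      sorted : AllPairs _≺_ (sort (byColourReversed id L))
      sorted = sort-sorted (byColourReversed id L)
                 (AllPairs-resp-↭ (λ ne e → ne (sym e)) (↭-sym perm) (AllPairs.map <⇒≢ L↑))
      ⊆ : ∀ z → z ∈ sort (byColourReversed id L) → z ∈ L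
      ⊆ z z∈ = ∈-resp-↭ perm (∈-resp-↭ (sort-↭ _) z∈)
      ⊇ : ∀ z → z ∈ L → z ∈ sort (byColourReversed id L)
      ⊇ z z∈ = ∈-resp-↭ (↭-sym (sort-↭ _)) (∈-resp-↭ (↭-sym perm) z∈)

    toLevel-word : ∀ col → colouredWord (toLevel col) ↭ columnWord col
    toLevel-word col = ↭-trans (colouredWord-↭ (sort-↭ (rowBlocks id col))) (↭-reflexive (colouredWord-rowBlocks id col))

    toLevel-isLevel : ∀ col → Unique (columnWord col) → 1 ≤ length (columnWord col) → IsLevel (toLevel col)
    toLevel-isLevel col col! col≢[] =
      nonempty , All-resp-↭ (↭-sym (sort-↭ B)) (rowBlocks-connected id col) ,
      sort-sorted B (distinct-leads B (subst Unique (sym (colouredWord-rowBlocks id col)) col!))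
      where
      B = rowBlocks id col
      nonempty : 1 ≤ length (toLevel col)
      nonempty with toLevel col | toLevel-word col
      ... | []    | p = subst (1 ≤_) (sym (↭-length p)) col≢[]
      ... | _ ∷ _ | _ = s≤s z≤n

    toColumn-word : ∀ L → columnWord (toColumn L) ↭ colouredWord L
    toColumn-word L = ↭-trans (↭-reflexive (columnWord-toColumn id L)) (colouredWord-↭ (byColourReversed-↭-id L))

    toColumn-nonempty : ∀ L → 1 ≤ length L → 1 ≤ length (columnWord (toColumn L))
    toColumn-nonempty (b ∷ L) _ = subst (1 ≤_) (↭-length (↭-sym (toColumn-word (b ∷ L)))) (s≤s z≤n)

module Ballots where

  open import Defs
  open import Data.Nat using (ℕ; s≤s; z≤n)
  open import Data.Nat.Properties using (≤-irrelevant; ≡-irrelevant)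
  open import Data.Fin using (Fin; _<_)
  open import Data.Fin.Properties using (<-irrelevant; <-trans)
  open import Data.List using (List; []; _∷_; _++_; concat; map; length)
  open import Data.List.Relation.Unary.All as All using (All; []; _∷_)
  import Data.List.Relation.Unary.AllPairs as AllPairs
  open import Data.List.Relation.Unary.Linked as Linked using (Linked; []; [-]; _∷_)
  open import Data.List.Relation.Unary.Linked.Properties using (Linked⇒AllPairs; AllPairs⇒Linked)
  open import Data.List.Relation.Unary.Unique.Propositional using (Unique)
  open import Data.List.Relation.Binary.Permutation.Propositional using (_↭_; ↭-refl; ↭-sym)
  open import Data.List.Relation.Binary.Permutation.Propositional.Properties using (++⁺; ↭-length)
  open import Data.Product using (Σ; _×_; _,_; proj₁; proj₂)
  open import Data.Product.Function.NonDependent.Propositional using (_×-↔_)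
  open import Data.Bool.Properties using (T-irrelevant)
  open import Function using (_∘_)
  open import Function.Bundles using (_↔_; mk↔ₛ′; Inverse)
  open import Function.Properties.Inverse using (↔-sym; ↔-refl)
  open import Relation.Nullary.Decidable using (toWitness; fromWitness)
  open import Relation.Binary.PropositionalEquality
  open Factorization
  open Matrices
  open Levels

  module RawBallots (n m : ℕ) where
    open Factorize n
    open ColumnLevel n m
    open SortBy colouredLead using (_≺_)
    open Fill {Fin n} using (word)
    open WordMatrix m n using (PermutedMatrix; NonemptyColumn; PermutedMatrix-irrelevant; Perm-irrelevant)

    ballotWord′ : List (List ColouredBlock) → List (Fin n)
    ballotWord′ ls = concat (map colouredWord ls)

    RawBallot : Set
    RawBallot = Σ (List (List ColouredBlock)) (λ ls → All IsLevel ls × Distinct (ballotWord′ ls) × length (ballotWord′ ls) ≡ n)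

    Distinct-resp-↭ : ∀ {xs ys : List (Fin n)} → xs ↭ ys → Distinct xs → Distinct ys
    Distinct-resp-↭ p d = fromWitness (Unique-resp-↭ p (toWitness d))

    IsLevel-irrelevant : ∀ {L} (p q : IsLevel L) → p ≡ q
    IsLevel-irrelevant (a , b , c) (a′ , b′ , c′) =
      cong₂ _,_ (≤-irrelevant a a′)
        (cong₂ _,_ (All.irrelevant (All.irrelevant <-irrelevant) b b′) (AllPairs.irrelevant <-irrelevant c c′))

    RawBallot-irrelevant : ∀ {ls} (p q : All IsLevel ls × Distinct (ballotWord′ ls) × length (ballotWord′ ls) ≡ n) → p ≡ q
    RawBallot-irrelevant (a , d , l) (a′ , d′ , l′) =
      cong₂ _,_ (All.irrelevant IsLevel-irrelevant a a′) (cong₂ _,_ (T-irrelevant d d′) (≡-irrelevant l l′))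

    Unique-concat : ∀ {A : Set} (f : A → List (Fin n)) xs → Unique (concat (map f xs)) → All (Unique ∘ f) xs
    Unique-concat f []       _  = []
    Unique-concat f (x ∷ xs) u = AllPairs-++⁻ˡ (f x) u ∷ Unique-concat f xs (AllPairs-++⁻ʳ (f x) u)

    toLevels-word : ∀ cs → ballotWord′ (map toLevel cs) ↭ word cs
    toLevels-word []       = ↭-refl
    toLevels-word (c ∷ cs) = ++⁺ (toLevel-word c) (toLevels-word cs)

    toColumns-word : ∀ ls → word (map toColumn ls) ↭ ballotWord′ ls
    toColumns-word []       = ↭-refl
    toColumns-word (L ∷ ls) = ++⁺ (toColumn-word L) (toColumns-word ls)

    PermutedMatrix↔RawBallot : PermutedMatrix ↔ RawBallot
    PermutedMatrix↔RawBallot = mk↔ₛ′ to from to∘from from∘to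
      where
      to : PermutedMatrix → RawBallot
      to (cs , cs≢[] , d , l) =
        map toLevel cs , levels cs cs≢[] (Unique-concat columnWord cs (toWitness d)) ,
        Distinct-resp-↭ (↭-sym (toLevels-word cs)) d , trans (↭-length (toLevels-word cs)) l
        where
        levels : ∀ cs → All NonemptyColumn cs → All (Unique ∘ columnWord) cs → All IsLevel (map toLevel cs)
        levels []       []         []         = []
        levels (c ∷ cs) (c≢[] ∷ ps) (c! ∷ us) = toLevel-isLevel c c! c≢[] ∷ levels cs ps us
      from : RawBallot → PermutedMatrix
      from (ls , ok , d , l) =
        map toColumn ls , nonempty ls ok ,
        Distinct-resp-↭ (↭-sym (toColumns-word ls)) d , trans (↭-length (toColumns-word ls)) l
        where
        nonempty : ∀ ls → All IsLevel ls → All NonemptyColumn (map toColumn ls)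
        nonempty []       []                 = []
        nonempty (L ∷ ls) ((L≢[] , _) ∷ ok) = toColumn-nonempty L L≢[] ∷ nonempty ls ok
      to∘from : ∀ y → to (from y) ≡ y
      to∘from (ls , ok , _) = Σ-≡-irrelevant RawBallot-irrelevant (inverse ls ok)
        where
        inverse : ∀ ls → All IsLevel ls → map toLevel (map toColumn ls) ≡ ls
        inverse []       []                       = refl
        inverse (L ∷ ls) ((_ , L-conn , L↑) ∷ ok) = cong₂ _∷_ (toLevel-toColumn L L↑ L-conn) (inverse ls ok)
      from∘to : ∀ x → from (to x) ≡ x
      from∘to (cs , _ , d , _) = Σ-≡-irrelevant PermutedMatrix-irrelevant (inverse cs (Unique-concat columnWord cs (toWitness d)))
        where
        inverse : ∀ cs → All (Unique ∘ columnWord) cs → map toColumn (map toLevel cs) ≡ cs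
        inverse []       []         = refl
        inverse (c ∷ cs) (c! ∷ us) = cong₂ _∷_ (toColumn-toLevel c c!) (inverse cs us)

    strip : CBlock n m → ColouredBlock
    strip ((b , _) , c) = b , c

    attach : (L : List ColouredBlock) → All (Connected ∘ proj₁) L → List (CBlock n m)
    attach []            []                = []
    attach ((b , c) ∷ L) (b-conn ∷ L-conn) = ((b , b-conn) , c) ∷ attach L L-conn

    strip-connected : (bs : List (CBlock n m)) → All (Connected ∘ proj₁) (map strip bs)
    strip-connected []                        = []
    strip-connected (((_ , b-conn) , _) ∷ bs) = b-conn ∷ strip-connected bs

    strip-attach : ∀ L L-conn → map strip (attach L L-conn) ≡ L
    strip-attach []            []           = refl
    strip-attach ((b , c) ∷ L) (_ ∷ L-conn) = cong ((b , c) ∷_) (strip-attach L L-conn)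

    attach-strip : ∀ bs → attach (map strip bs) (strip-connected bs) ≡ bs
    attach-strip []                        = refl
    attach-strip (((b , b-conn) , c) ∷ bs) = cong (((b , b-conn) , c) ∷_) (attach-strip bs)

    _<ᶜ_ : CBlock n m → CBlock n m → Set
    b <ᶜ c = firstLetter (proj₁ b) < firstLetter (proj₁ c)

    strip-linked : ∀ bs → Linked _<ᶜ_ bs → Linked _≺_ (map strip bs)
    strip-linked []           []          = []
    strip-linked (_ ∷ [])     [-]         = [-]
    strip-linked (_ ∷ b ∷ bs) (r ∷ bs↑)  = r ∷ strip-linked (b ∷ bs) bs↑

    attach-linked : ∀ L L-conn → Linked _≺_ L → Linked _<ᶜ_ (attach L L-conn)
    attach-linked []           []             []        = []
    attach-linked (_ ∷ [])     (_ ∷ [])       [-]       = [-]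
    attach-linked (_ ∷ b ∷ L) (_ ∷ pb ∷ ps) (r ∷ L↑) = r ∷ attach-linked (b ∷ L) (pb ∷ ps) L↑

    Level↔IsLevel : Level n m ↔ Σ (List ColouredBlock) IsLevel
    Level↔IsLevel = mk↔ₛ′ to from to∘from from∘to
      where
      to : Level n m → Σ (List ColouredBlock) IsLevel
      to ((b₀ , bs) , bs↑) =
        map strip (b₀ ∷ bs) , s≤s z≤n , strip-connected (b₀ ∷ bs) ,
        Linked⇒AllPairs (λ {a} {b} {c} → <-trans {i = colouredLead a} {j = colouredLead b} {k = colouredLead c})
                        (strip-linked (b₀ ∷ bs) bs↑)
      from : Σ (List ColouredBlock) IsLevel → Level n m
      from ((b , c) ∷ L , _ , b-conn ∷ L-conn , L↑) =
        (((b , b-conn) , c) , attach L L-conn) , attach-linked ((b , c) ∷ L) (b-conn ∷ L-conn) (AllPairs⇒Linked L↑)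
      to∘from : ∀ y → to (from y) ≡ y
      to∘from ((b , c) ∷ L , _ , _ ∷ L-conn , _) = Σ-≡-irrelevant IsLevel-irrelevant (cong ((b , c) ∷_) (strip-attach L L-conn))
      from∘to : ∀ x → from (to x) ≡ x
      from∘to ((b₀ , bs) , _) = Σ-≡-irrelevant (Linked.irrelevant <-irrelevant) (cong (b₀ ,_) (attach-strip bs))

    Levels↔AllIsLevel : List (Level n m) ↔ Σ (List (List ColouredBlock)) (All IsLevel)
    Levels↔AllIsLevel = mk↔ₛ′ to from to∘from from∘to
      where
      open Inverse Level↔IsLevel using () renaming (to to toL; from to fromL; strictlyInverseˡ to toL∘fromL; strictlyInverseʳ to fromL∘toL)
      to : List (Level n m) → Σ (List (List ColouredBlock)) (All IsLevel)
      to []       = [] , []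
      to (l ∷ ls) = proj₁ (toL l) ∷ proj₁ (to ls) , proj₂ (toL l) ∷ proj₂ (to ls)
      from : Σ (List (List ColouredBlock)) (All IsLevel) → List (Level n m)
      from ([]     , [])     = []
      from (L ∷ Ls , p ∷ ps) = fromL (L , p) ∷ from (Ls , ps)
      to∘from : ∀ y → to (from y) ≡ y
      to∘from ([]     , [])     = refl
      to∘from (L ∷ Ls , p ∷ ps) = cong₂ (λ a b → proj₁ a ∷ proj₁ b , proj₂ a ∷ proj₂ b) (toL∘fromL (L , p)) (to∘from (Ls , ps))
      from∘to : ∀ x → from (to x) ≡ x
      from∘to []       = refl
      from∘to (l ∷ ls) = cong₂ _∷_ (fromL∘toL l) (from∘to ls)

    ballotWord-strip : ∀ ls → ballotWord ls ≡ ballotWord′ (proj₁ (Inverse.to Levels↔AllIsLevel ls))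
    ballotWord-strip []                             = refl
    ballotWord-strip (((((b , _) , _) , bs) , _) ∷ ls) = cong₂ _++_ (cong (proj₁ b ∷_) (cong (proj₂ b ++_) (levelWord bs))) (ballotWord-strip ls)
      where
      levelWord : ∀ bs → concat (map (λ b → wordOf (proj₁ b)) bs) ≡ colouredWord (map strip bs)
      levelWord []                   = refl
      levelWord (((w , _) , _) ∷ bs) = cong (proj₁ w ∷_) (cong (proj₂ w ++_) (levelWord bs))

    Bal↔RawBallot : Bal m n ↔ RawBallot
    Bal↔RawBallot = mk↔ₛ′ to from to∘from from∘to
      where
      open Inverse Levels↔AllIsLevel using () renaming (to to toLs; from to fromLs; strictlyInverseˡ to toLs∘fromLs; strictlyInverseʳ to fromLs∘toLs)
      to : Bal m n → RawBallot
      to (ls , d , l) = proj₁ (toLs ls) , proj₂ (toLs ls) ,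
                        subst Distinct (ballotWord-strip ls) d , trans (cong length (sym (ballotWord-strip ls))) l
      ballotWord-from : ∀ y → ballotWord (fromLs y) ≡ ballotWord′ (proj₁ y)
      ballotWord-from y = trans (ballotWord-strip (fromLs y)) (cong (ballotWord′ ∘ proj₁) (toLs∘fromLs y))
      from : RawBallot → Bal m n
      from (ls , ok , d , l) = fromLs (ls , ok) ,
                               subst Distinct (sym (ballotWord-from (ls , ok))) d , trans (cong length (ballotWord-from (ls , ok))) l
      RawBallot-≡ : ∀ {y ls ok} → y ≡ (ls , ok) → ∀ d′ l′ d l → _≡_ {A = RawBallot} (proj₁ y , proj₂ y , d′ , l′) (ls , ok , d , l)
      RawBallot-≡ refl d′ l′ d l = cong₂ (λ x y → _ , _ , x , y) (T-irrelevant d′ d) (≡-irrelevant l′ l)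
      to∘from : ∀ y → to (from y) ≡ y
      to∘from (ls , ok , d , l) = RawBallot-≡ (toLs∘fromLs (ls , ok)) _ _ d l
      from∘to : ∀ x → from (to x) ≡ x
      from∘to (ls , _) = Σ-≡-irrelevant Perm-irrelevant (fromLs∘toLs ls)

  SxG↔Bal : ∀ n m → SxG m n ↔ Bal m n
  SxG↔Bal n m = (↔-refl ×-↔ G↔StandardMatrix) ⟨↔⟩ Perm×StandardMatrix↔PermutedMatrix
                ⟨↔⟩ PermutedMatrix↔RawBallot ⟨↔⟩ ↔-sym Bal↔RawBallot
    where
    open WordMatrix m n
    open RawBallots n m

proposition4p6 : (n m : ℕ) →
    (SxG m n ↔ Bal m n) ×
    Σ ℕ (λ c → (G m n ↔ Fin c) ×
    ((n !) * c ≡ sumTo n (λ k → stirling1 n k * m ^ k * fub k)))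
proposition4p6 n m =
  Ballots.SxG↔Bal n m ,
  Counting.∑ (suc n) (λ j → Counting.MatrixCount.matrices m j n) ,
  Matrices.WordMatrix.G↔Fin m n ,
  Counting.StirlingSum.factorial-∑matrices m n
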